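{- Let $\alpha=(\alpha_1,\dots,\alpha_m)$ be a strong composition of $n\ge1$ and $\delta=(\delta_1,\dots,\delta_m)$ a weak composition of $k$ with $\delta_1=0$. Set $n_\ell=\alpha_1+\cdots+\alpha_\ell$ and $k_\ell=\delta_1+\cdots+\delta_\ell$. Then $$\widetilde{\mathcal{W}}_{\alpha,\delta}^{\mathrm{maj}}(q)=\prod_{\ell=2}^m q^{k_\ell\alpha_\ell}\binom{n_{\ell-1}-k_{\ell-1}}{\delta_\ell}_q\left(\!\!\binom{k_\ell}{\alpha_\ell-\delta_\ell}\!\!\right)_{q^{ -1}}=q^{\eta(\alpha,\delta)}\prod_{\ell=2}^m\binom{n_{\ell-1}-k_{\ell-1}}{\delta_\ell}_q\left(\!\!\binom{k_\ell}{\alpha_\ell-\delta_\ell}\!\!\right)_q,$$ where $\eta(\alpha,\delta)=n-\alpha_1+\binom{k}{2}+\sum_{\ell=2}^m\binom{\delta_\ell}{2}$.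
   Context: A word of length $n$ is a sequence $w=w_1\cdots w_n$ of positive integers; its content is the sequence whose $j$-th entry is the number of $j$'s. $\mathrm{maj}(w)=\sum_{1\le i<n,\,w_i>w_{i+1}}i$. $\mathrm{cdes}(w)=\#\{1\le i\le n:w_i>w_{i+1}\}$ with indices mod $n$ (empty word: 0). $w^{(i)}$ is the subsequence of letters $\le i$. For $w$ of content $\alpha$ with $m$ parts, $\mathrm{CDT}(w)=(\mathrm{cdes}(w^{(1)}),\mathrm{cdes}(w^{(2)})-\mathrm{cdes}(w^{(1)}),\dots,\mathrm{cdes}(w^{(m)})-\mathrm{cdes}(w^{(m-1)}))$. $\widetilde{\mathcal{W}}_{\alpha,\delta}$ is the set of words with content $\alpha$, $\mathrm{CDT}=\delta$, and last letter $1$; $\widetilde{\mathcal{W}}_{\alpha,\delta}^{\mathrm{maj}}(q)=\sum_{w\in\widetilde{\mathcal{W}}_{\alpha,\delta}}q^{\mathrm{maj}(w)}$. $q$-analogues: $[a]_q=1+q+\cdots+q^{a-1}$, $[a]_q!=[a]_q\cdots[1]_q$, $\binom{a}{b}_q=\frac{[a]_q!}{[b]_q![a-b]_q!}$ for $0\le b\le a$ and $0$ otherwise (equivalently $q^{ -\binom b2}e_b(1,q,\dots,q^{a-1})$); $\left(\!\binom{N}{j}\!\right)_q=h_j(1,q,\dots,q^{N-1})$, the complete homogeneous symmetric polynomial, which equals $\binom{N+j-1}{j}_q$ for $N\ge1$, equals $1$ if $N=j=0$, and $0$ if $N=0<j$. The subscript $q^{ -1}$ means substitute $q^{ -1}$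 for $q$. -}

module Defs where

open import Level using (Level)
open import Data.Bool using (Bool; true; false; _∧_; if_then_else_)
open import Data.Nat as ℕ using (ℕ; zero; suc; _∸_; _<ᵇ_; _≤ᵇ_; _≡ᵇ_)
open import Data.Nat.ListAction using (sum)
open import Data.Nat.Combinatorics using (_C_)
open import Data.Integer as ℤ using (ℤ; +_)
open import Data.List using (List; []; _∷_; _++_; [_]; map; upTo; concatMap; filterᵇ; length; take; foldr; zipWith)
open import Data.List.Properties using (≡-dec)
open import Relation.Nullary using (does)
open import Algebra.Bundles using (CommutativeRing)

-- Words: lists of positive integers

Word : Set
Word = List ℕ

-- 1-indexed access (default 0 out of range)
nth : List ℕ → ℕ → ℕ
nth []       _             = 0
nth (x ∷ xs) zero          = 0
nth (x ∷ xs) (suc zero)    = x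
nth (x ∷ xs) (suc (suc i)) = nth xs (suc i)

psum : List ℕ → ℕ → ℕ
psum xs ℓ = sum (take ℓ xs)

allWords : ℕ → ℕ → List Word
allWords m zero    = [] ∷ []
allWords m (suc n) = concatMap (λ a → map (a ∷_) (allWords m n)) (map suc (upTo m))

count : ℕ → Word → ℕ
count j []       = 0
count j (x ∷ xs) = (if j ≡ᵇ x then 1 else 0) ℕ.+ count j xs

content : ℕ → Word → List ℕ
content m w = map (λ i → count (suc i) w) (upTo m)

majFrom : ℕ → Word → ℕ
majFrom i []           = 0
majFrom i (x ∷ [])     = 0
majFrom i (x ∷ y ∷ xs) = (if y <ᵇ x then i else 0) ℕ.+ majFrom (suc i) (y ∷ xs)

maj : Word → ℕ
maj = majFrom 1

descPairs : List ℕ → List ℕ → ℕ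
descPairs as bs = sum (zipWith (λ a b → if b <ᵇ a then 1 else 0) as bs)

-- cyclic descents (indices mod n); empty word gives 0
cdes : Word → ℕ
cdes []       = 0
cdes (x ∷ xs) = descPairs (x ∷ xs) (xs ++ [ x ])

restrict : ℕ → Word → Word
restrict i = filterᵇ (λ x → x ≤ᵇ i)

CDT : ℕ → Word → List ℤ
CDT m w = map (λ i → (+ cdes (restrict (suc i) w)) ℤ.- (+ cdes (restrict i w))) (upTo m)

lastIs1 : Word → Bool
lastIs1 []           = false
lastIs1 (x ∷ [])     = x ≡ᵇ 1
lastIs1 (x ∷ y ∷ xs) = lastIs1 (y ∷ xs)

-- membership test for \tilde W_{α,δ} (words from allWords m n)
inW : List ℕ → List ℕ → Word → Bool
inW α δ w =
  does (≡-dec ℕ._≟_ (content (length α) w) α)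
  ∧ does (≡-dec ℤ._≟_ (CDT (length α) w) (map +_ δ))
  ∧ lastIs1 w

-- Ring-valued quantities (evaluated at q in an arbitrary commutative ring)

module RingDefs {c ℓ : Level} (R : CommutativeRing c ℓ) where
  open CommutativeRing R

  pow : Carrier → ℕ → Carrier
  pow x zero    = 1#
  pow x (suc n) = x * pow x n

  prod : List Carrier → Carrier
  prod = foldr _*_ 1#

  esym : ℕ → List Carrier → Carrier
  esym zero    xs       = 1#
  esym (suc b) []       = 0#
  esym (suc b) (x ∷ xs) = x * esym b xs + esym (suc b) xs

  hsym : ℕ → List Carrier → Carrier
  hsym zero    xs       = 1#
  hsym (suc j) []       = 0#
  hsym (suc j) (x ∷ xs) = x * hsym j (x ∷ xs) + hsym (suc j) xs

  powers : Carrier → ℕ → List Carrier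
  powers x N = map (pow x) (upTo N)

  Wmaj : Carrier → List ℕ → List ℕ → Carrier
  Wmaj q α δ = foldr (λ w acc → (if inW α δ w then pow q (maj w) else 0#) + acc) 0#
                     (allWords (length α) (sum α))

  -- q-binomial (a choose b)_q with a = a₁ - a₂ an integer; zero unless 0 ≤ b ≤ a.
  -- Uses (a choose b)_q = q^{-(b choose 2)} e_b(1,q,…,q^{a-1}); q⁻ is an inverse of q.
  qbinom : Carrier → Carrier → ℕ → ℕ → ℕ → Carrier
  qbinom q q⁻ a₁ a₂ b = if a₂ ≤ᵇ a₁ then pow q⁻ (b C 2) * esym b (powers q (a₁ ∸ a₂)) else 0#

  -- ((N choose j))_x = h_j(1,x,…,x^{N-1}) with j = j₁ - j₂; zero if j < 0
  multichoose : Carrier → ℕ → ℕ → ℕ → Carrier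
  multichoose x N j₁ j₂ = if j₂ ≤ᵇ j₁ then hsym (j₁ ∸ j₂) (powers x N) else 0#

  from2 : ℕ → List ℕ
  from2 m = map (λ i → suc (suc i)) (upTo (m ∸ 1))

  rhs₁ : Carrier → Carrier → List ℕ → List ℕ → Carrier
  rhs₁ q q⁻ α δ = prod (map (λ l →
      pow q (psum δ l ℕ.* nth α l)
    * qbinom q q⁻ (psum α (l ∸ 1)) (psum δ (l ∸ 1)) (nth δ l)
    * multichoose q⁻ (psum δ l) (nth α l) (nth δ l)) (from2 (length α)))

  eta : List ℕ → List ℕ → ℕ
  eta α δ = (sum α ∸ nth α 1) ℕ.+ (sum δ C 2) ℕ.+ sum (map (λ l → nth δ l C 2) (from2 (length α)))

  rhs₂ : Carrier → Carrier → List ℕ → List ℕ → Carrier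
  rhs₂ q q⁻ α δ = pow q (eta α δ) * prod (map (λ l →
      qbinom q q⁻ (psum α (l ∸ 1)) (psum δ (l ∸ 1)) (nth δ l)
    * multichoose q (psum δ l) (nth α l) (nth δ l)) (from2 (length α)))

module Submission where

-- Induction on the number m of parts, removing the largest letter L = m.  A word v over
-- {1,…,L} is, uniquely, an insertion of a copies of L into the word u of its letters < L
-- (Insertion, Decomposition).  As the last letter is 1, cyclic descents are descents, so
-- v ∈ W̃(α,δ) iff a = α_m, u ∈ W̃(α',δ'), des v = des u + δ_m and v does not end with L
-- (Step.membership).  The insertion lemma (InsertionSum.insertionSum) evaluates, for u with
-- K descents and length K + 1 + M, the sum of q^maj(v) over the insertions with d new descents:
--   q^maj(u) · q^{dK + (d choose 2) + a} e_d(1,…,q^M) h_{a-d}(1,…,q^{K+d-1}),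
-- by a simultaneous induction on u using the q-Pascal recurrences (QSymmetric, ClosedForms).
-- Rewriting h at q⁻¹ (AtInverse) turns this into the ℓ = m factor of the first product, so
-- W̃(α,δ) = W̃(α',δ') · factor (Step.wordSumStep).  The two products differ factorwise by
-- q^{k_ℓ δ_ℓ + α_ℓ - δ_ℓ}, which add up to q^η (Products, Induction).

open import Defs
open import Level using (Level)
open import Data.Bool using (Bool; true; false; _∧_; not; if_then_else_; T)
import Data.Bool.Properties as BP
open import Data.Unit using (tt)
open import Data.Empty using (⊥; ⊥-elim)
open import Data.Nat as ℕ using (ℕ; zero; suc; _∸_; _≤_; _<_; z≤n; s≤s; _≡ᵇ_; _≤ᵇ_; _<ᵇ_)
import Data.Nat.Properties as NP
open import Data.Nat.Combinatorics using (_C_; nC1≡n; nCk+nC[k+1]≡[n+1]C[k+1])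
open import Data.Nat.Tactic.RingSolver using (solve-∀)
open import Data.Nat.ListAction using (sum)
open import Data.Integer as ℤ using (ℤ)
import Data.Integer.Properties as ZP
open import Data.List using (List; []; _∷_; _++_; [_]; map; upTo; concatMap; concat; foldr; length; take)
import Data.List.Properties as LP
open import Data.List.Relation.Unary.All as All using (All; []; _∷_)
import Data.List.Relation.Unary.All.Properties as AllP
open import Data.Product using (Σ-syntax; _×_; _,_; proj₁; proj₂)
open import Data.Sum using (_⊎_; inj₁; inj₂)
open import Relation.Nullary using (Dec; yes; no; does)
open import Relation.Binary.PropositionalEquality as P using (_≡_; refl)
open import Relation.Binary.Definitions using (tri<; tri≈; tri>)
open import Algebra.Bundles using (CommutativeRing)
import Relation.Binary.Reasoning.Setoid as SetoidReasoning

¬T⇒false : ∀ {b} → (T b → ⊥) → b ≡ false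
¬T⇒false {true}  h = ⊥-elim (h tt)
¬T⇒false {false} h = refl

T⇒true : ∀ {b} → T b → b ≡ true
T⇒true {true} _ = refl

true⇒T : ∀ {b} → b ≡ true → T b
true⇒T refl = tt

<ᵇ-true : ∀ {m n} → m < n → (m <ᵇ n) ≡ true
<ᵇ-true h = T⇒true (NP.<⇒<ᵇ h)

<ᵇ-false : ∀ {m n} → n ≤ m → (m <ᵇ n) ≡ false
<ᵇ-false {m} {n} h = ¬T⇒false (λ t → NP.<⇒≱ (NP.<ᵇ⇒< m n t) h)

≤ᵇ-true : ∀ {m n} → m ≤ n → (m ≤ᵇ n) ≡ true
≤ᵇ-true h = T⇒true (NP.≤⇒≤ᵇ h)

≤ᵇ-false : ∀ {m n} → n < m → (m ≤ᵇ n) ≡ false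
≤ᵇ-false {m} {n} h = ¬T⇒false (λ t → NP.<⇒≱ h (NP.≤ᵇ⇒≤ m n t))

≡ᵇ-refl : ∀ n → (n ≡ᵇ n) ≡ true
≡ᵇ-refl n = T⇒true (NP.≡⇒≡ᵇ n n refl)

≡ᵇ-false : ∀ {m n} → (m ≡ n → ⊥) → (m ≡ᵇ n) ≡ false
≡ᵇ-false {m} {n} h = ¬T⇒false (λ t → h (NP.≡ᵇ⇒≡ m n t))

≡ᵇ-false-< : ∀ {m n} → m < n → (m ≡ᵇ n) ≡ false
≡ᵇ-false-< m<n = ≡ᵇ-false (λ e → NP.<-irrefl e m<n)

does-reflects : ∀ {p} {Q : Set p} (d : Dec Q) (b : Bool) → (Q → T b) → (T b → Q) → does d ≡ b
does-reflects (yes q) true  f g = refl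
does-reflects (yes q) false f g = ⊥-elim (f q)
does-reflects (no ¬q) true  f g = ⊥-elim (¬q (g tt))
does-reflects (no ¬q) false f g = refl

does-true : ∀ {Q : Set} (d : Dec Q) → does d ≡ true → Q
does-true (yes p) _ = p

∧-true : ∀ x y → x ∧ y ≡ true → x ≡ true × y ≡ true
∧-true true true _ = refl , refl

C2-suc : ∀ d → suc d C 2 ≡ d C 2 ℕ.+ d
C2-suc d = P.trans (P.sym (nCk+nC[k+1]≡[n+1]C[k+1] d 1))
                   (P.trans (P.cong (ℕ._+ d C 2) (nC1≡n d)) (NP.+-comm d _))

C2-+ : ∀ x y → (x ℕ.+ y) C 2 ≡ x C 2 ℕ.+ x ℕ.* y ℕ.+ y C 2
C2-+ x zero rewrite NP.+-identityʳ x | NP.*-zeroʳ x | NP.+-identityʳ (x C 2) | NP.+-identityʳ (x C 2) = refl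
C2-+ x (suc y) = begin
  (x ℕ.+ suc y) C 2                               ≡⟨ P.cong (_C 2) (NP.+-suc x y) ⟩
  suc (x ℕ.+ y) C 2                               ≡⟨ C2-suc (x ℕ.+ y) ⟩
  (x ℕ.+ y) C 2 ℕ.+ (x ℕ.+ y)                     ≡⟨ P.cong (ℕ._+ (x ℕ.+ y)) (C2-+ x y) ⟩
  x C 2 ℕ.+ x ℕ.* y ℕ.+ y C 2 ℕ.+ (x ℕ.+ y)       ≡⟨ regroup (x C 2) (x ℕ.* y) (y C 2) x y ⟩
  x C 2 ℕ.+ (x ℕ.+ x ℕ.* y) ℕ.+ (y C 2 ℕ.+ y)     ≡⟨ P.cong₂ (λ a b → x C 2 ℕ.+ a ℕ.+ b) (P.sym (NP.*-suc x y)) (P.sym (C2-suc y)) ⟩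
  x C 2 ℕ.+ x ℕ.* suc y ℕ.+ suc y C 2             ∎
  where
  open P.≡-Reasoning
  regroup : ∀ a b c x y → a ℕ.+ b ℕ.+ c ℕ.+ (x ℕ.+ y) ≡ a ℕ.+ (x ℕ.+ b) ℕ.+ (c ℕ.+ y)
  regroup = solve-∀

C2-sq : ∀ d → d C 2 ℕ.+ d C 2 ℕ.+ d ≡ d ℕ.* d
C2-sq zero = refl
C2-sq (suc d) rewrite C2-suc d = P.trans (regroup (d C 2) d)
    (P.trans (P.cong (λ k → k ℕ.+ d ℕ.+ d ℕ.+ 1) (C2-sq d)) (P.sym (square d)))
  where
  regroup : ∀ c d → c ℕ.+ d ℕ.+ (c ℕ.+ d) ℕ.+ suc d ≡ c ℕ.+ c ℕ.+ d ℕ.+ d ℕ.+ d ℕ.+ 1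
  regroup = solve-∀
  square : ∀ d → suc d ℕ.* suc d ≡ d ℕ.* d ℕ.+ d ℕ.+ d ℕ.+ 1
  square = solve-∀

-- Lists viewed from the right end: the induction appends the last part of α and δ.

snocView : ∀ {A : Set} (xs : List A) m → length xs ≡ suc m →
           Σ[ ys ∈ List A ] Σ[ y ∈ A ] (xs ≡ ys ++ [ y ] × length ys ≡ m)
snocView (x ∷ []) zero h = [] , x , refl , refl
snocView (x ∷ x' ∷ xs) (suc m) h with snocView (x' ∷ xs) m (NP.suc-injective h)
... | ys , y , e , l = x ∷ ys , y , P.cong (x ∷_) e , P.cong suc l

length-snoc : ∀ {A : Set} (xs : List A) y → length (xs ++ [ y ]) ≡ suc (length xs)
length-snoc xs y = P.trans (LP.length-++ xs) (NP.+-comm (length xs) 1)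

sum-snoc : ∀ xs y → sum (xs ++ [ y ]) ≡ sum xs ℕ.+ y
sum-snoc []       y = NP.+-identityʳ y
sum-snoc (x ∷ xs) y = P.trans (P.cong (x ℕ.+_) (sum-snoc xs y)) (P.sym (NP.+-assoc x _ y))

map-upTo-snoc : ∀ {a} {A : Set a} (f : ℕ → A) m → map f (upTo (suc m)) ≡ map f (upTo m) ++ [ f m ]
map-upTo-snoc f m = P.trans (P.cong (map f) (P.sym (LP.upTo-∷ʳ m))) (LP.map-++ f (upTo m) [ m ])

upTo-< : ∀ n → All (_< n) (upTo n)
upTo-< n = AllP.applyUpTo⁺₁ (λ x → x) n (λ h → h)

nth-snoc : ∀ xs y l → 1 ≤ l → l ≤ length xs → nth (xs ++ [ y ]) l ≡ nth xs l
nth-snoc (x ∷ xs) y (suc zero)    _ _       = refl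
nth-snoc (x ∷ xs) y (suc (suc i)) _ (s≤s h) = nth-snoc xs y (suc i) (s≤s z≤n) h

nth-last : ∀ xs y → nth (xs ++ [ y ]) (suc (length xs)) ≡ y
nth-last []       y = refl
nth-last (x ∷ xs) y = nth-last xs y

take-snoc : ∀ (xs : List ℕ) y l → l ≤ length xs → take l (xs ++ [ y ]) ≡ take l xs
take-snoc xs       y zero    _       = refl
take-snoc (x ∷ xs) y (suc l) (s≤s h) = P.cong (x ∷_) (take-snoc xs y l h)

psum-snoc : ∀ xs y l → l ≤ length xs → psum (xs ++ [ y ]) l ≡ psum xs l
psum-snoc xs y l h = P.cong sum (take-snoc xs y l h)

psum-all : ∀ xs y → psum (xs ++ [ y ]) (length xs) ≡ sum xs
psum-all xs y = P.trans (psum-snoc xs y (length xs) NP.≤-refl) (P.cong sum (LP.take-all (length xs) xs NP.≤-refl))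

nth1≤sum : ∀ xs → nth xs 1 ≤ sum xs
nth1≤sum []       = z≤n
nth1≤sum (x ∷ xs) = NP.m≤m+n x _

psum-all-snoc : ∀ xs y → psum (xs ++ [ y ]) (suc (length xs)) ≡ sum xs ℕ.+ y
psum-all-snoc xs y = P.trans (P.cong sum (LP.take-all (suc (length xs)) (xs ++ [ y ]) (NP.≤-reflexive (length-snoc xs y)))) (sum-snoc xs y)

ind : Bool → ℕ
ind b = if b then 1 else 0

des : Word → ℕ
des []          = 0
des (x ∷ [])    = 0
des (x ∷ y ∷ r) = ind (y <ᵇ x) ℕ.+ des (y ∷ r)

-- Shifting every descent position by one adds des w to the major index.
majFrom-suc : ∀ i w → majFrom (suc i) w ≡ majFrom i w ℕ.+ des w
majFrom-suc i []          = refl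
majFrom-suc i (x ∷ [])    = refl
majFrom-suc i (x ∷ y ∷ r) rewrite majFrom-suc (suc i) (y ∷ r) = step (y <ᵇ x)
  where
  step : ∀ b → (if b then suc i else 0) ℕ.+ (majFrom (suc i) (y ∷ r) ℕ.+ des (y ∷ r))
             ≡ (if b then i else 0) ℕ.+ majFrom (suc i) (y ∷ r) ℕ.+ (ind b ℕ.+ des (y ∷ r))
  step true  = P.trans (P.cong suc (P.sym (NP.+-assoc i _ _))) (P.sym (NP.+-suc (i ℕ.+ majFrom (suc i) (y ∷ r)) _))
  step false = refl

maj-cons : ∀ x y r → maj (x ∷ y ∷ r) ≡ ind (y <ᵇ x) ℕ.+ (maj (y ∷ r) ℕ.+ des (y ∷ r))
maj-cons x y r = P.cong (ind (y <ᵇ x) ℕ.+_) (majFrom-suc 1 (y ∷ r))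

des<length : ∀ x r → des (x ∷ r) < length (x ∷ r)
des<length x []      = s≤s z≤n
des<length x (y ∷ r) with y <ᵇ x
... | true  = s≤s (des<length y r)
... | false = NP.m<n⇒m<1+n (des<length y r)

lastLetter : Word → ℕ
lastLetter []          = 0
lastLetter (x ∷ [])    = x
lastLetter (x ∷ y ∷ r) = lastLetter (y ∷ r)

lastIs1≡ : ∀ w → lastIs1 w ≡ (lastLetter w ≡ᵇ 1)
lastIs1≡ []          = refl
lastIs1≡ (x ∷ [])    = refl
lastIs1≡ (x ∷ y ∷ r) = lastIs1≡ (y ∷ r)

cdes-unfold : ∀ x xs y → descPairs (x ∷ xs) (xs ++ [ y ]) ≡ des (x ∷ xs) ℕ.+ ind (y <ᵇ lastLetter (x ∷ xs))
cdes-unfold x []       y = NP.+-identityʳ _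
cdes-unfold x (z ∷ zs) y = P.trans (P.cong (ind (z <ᵇ x) ℕ.+_) (cdes-unfold z zs y)) (P.sym (NP.+-assoc (ind (z <ᵇ x)) _ _))

-- For a word of positive letters ending in 1 there is no wrap-around descent.
cdes≡des : ∀ w → lastIs1 w ≡ true → All (1 ≤_) w → cdes w ≡ des w
cdes≡des (x ∷ xs) h (1≤x ∷ _) = begin
  descPairs (x ∷ xs) (xs ++ [ x ])                  ≡⟨ cdes-unfold x xs x ⟩
  des (x ∷ xs) ℕ.+ ind (x <ᵇ lastLetter (x ∷ xs))    ≡⟨ P.cong (λ l → des (x ∷ xs) ℕ.+ ind (x <ᵇ l)) last≡1 ⟩
  des (x ∷ xs) ℕ.+ ind (x <ᵇ 1)                      ≡⟨ P.cong (λ b → des (x ∷ xs) ℕ.+ ind b) (<ᵇ-false 1≤x) ⟩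
  des (x ∷ xs) ℕ.+ 0                                 ≡⟨ NP.+-identityʳ _ ⟩
  des (x ∷ xs)                                       ∎
  where
  open P.≡-Reasoning
  last≡1 : lastLetter (x ∷ xs) ≡ 1
  last≡1 = NP.≡ᵇ⇒≡ _ _ (true⇒T (P.trans (P.sym (lastIs1≡ (x ∷ xs))) h))

restrict-cons : ∀ i x v → restrict i (x ∷ v) ≡ (if x ≤ᵇ i then x ∷ restrict i v else restrict i v)
restrict-cons i x v with x ≤ᵇ i
... | true  = refl
... | false = refl

restrict-all : ∀ i w → All (_≤ i) w → restrict i w ≡ w
restrict-all i []      _        = refl
restrict-all i (x ∷ w) (p ∷ ps) rewrite restrict-cons i x w | ≤ᵇ-true p = P.cong (x ∷_) (restrict-all i w ps)

restrict-zero : ∀ w → All (1 ≤_) w → restrict 0 w ≡ []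
restrict-zero []      _        = refl
restrict-zero (x ∷ w) (p ∷ ps) rewrite restrict-cons 0 x w | ≤ᵇ-false p = restrict-zero w ps

count-absent : ∀ j w → All (_< j) w → count j w ≡ 0
count-absent j []      _        = refl
count-absent j (x ∷ w) (p ∷ ps) rewrite ≡ᵇ-false {j} {x} (λ e → NP.<-irrefl (P.sym e) p) = count-absent j w ps

content-snoc : ∀ m w → content (suc m) w ≡ content m w ++ [ count (suc m) w ]
content-snoc m w = map-upTo-snoc (λ i → count (suc i) w) m

cdesStep : ℕ → Word → ℤ
cdesStep i w = (ℤ.+ cdes (restrict (suc i) w)) ℤ.- (ℤ.+ cdes (restrict i w))

CDT-snoc : ∀ m w → CDT (suc m) w ≡ CDT m w ++ [ cdesStep m w ]
CDT-snoc m w = map-upTo-snoc (λ i → cdesStep i w) m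

length-content : ∀ m w → length (content m w) ≡ m
length-content m w = P.trans (LP.length-map _ (upTo m)) (LP.length-upTo m)

length-CDT : ∀ m w → length (CDT m w) ≡ m
length-CDT m w = P.trans (LP.length-map _ (upTo m)) (LP.length-upTo m)

diff≡⇒ : ∀ A B d → (ℤ.+ A ℤ.- ℤ.+ B ≡ ℤ.+ d) → A ≡ B ℕ.+ d
diff≡⇒ A B d h with B NP.≤? A
... | yes B≤A = P.trans (P.sym (NP.m+[n∸m]≡n B≤A))
                  (P.cong (B ℕ.+_) (ZP.+-injective (P.trans (P.sym (ZP.⊖-≥ B≤A)) (P.trans (P.sym (ZP.m-n≡m⊖n A B)) h))))
-- B > A is impossible: then A - B is negative.
... | no B≰A with B ∸ A | NP.m<n⇒0<n∸m (NP.≰⇒> B≰A) | P.trans (P.sym (ZP.⊖-< (NP.≰⇒> B≰A))) (P.trans (P.sym (ZP.m-n≡m⊖n A B)) h)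
...   | suc _ | _ | ()

⇒diff≡ : ∀ A B d → A ≡ B ℕ.+ d → ℤ.+ A ℤ.- ℤ.+ B ≡ ℤ.+ d
⇒diff≡ A B d refl = P.trans (ZP.m-n≡m⊖n (B ℕ.+ d) B) (P.trans (ZP.⊖-≥ (NP.m≤m+n B d)) (P.cong ℤ.+_ (NP.m+n∸m≡n B d)))

diff-test : ∀ A B d → does ((ℤ.+ A ℤ.- ℤ.+ B) ℤ.≟ ℤ.+ d) ≡ (A ≡ᵇ B ℕ.+ d)
diff-test A B d = does-reflects ((ℤ.+ A ℤ.- ℤ.+ B) ℤ.≟ ℤ.+ d) _
  (λ h → NP.≡⇒≡ᵇ A (B ℕ.+ d) (diff≡⇒ A B d h)) (λ t → ⇒diff≡ A B d (NP.≡ᵇ⇒≡ A (B ℕ.+ d) t))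

≡-dec-snoc : ∀ {A : Set} (_≟_ : (x y : A) → Dec (x ≡ y)) (xs ys : List A) (x y : A) → length xs ≡ length ys →
             does (LP.≡-dec _≟_ (xs ++ [ x ]) (ys ++ [ y ])) ≡ does (LP.≡-dec _≟_ xs ys) ∧ does (x ≟ y)
≡-dec-snoc _≟_ []        []        x y h = BP.∧-identityʳ (does (x ≟ y))
≡-dec-snoc _≟_ (x' ∷ xs) (y' ∷ ys) x y h =
  P.trans (P.cong (does (x' ≟ y') ∧_) (≡-dec-snoc _≟_ xs ys x y (NP.suc-injective h))) (P.sym (BP.∧-assoc (does (x' ≟ y')) _ _))

cdes-telescope : ∀ m w (δ : List ℕ) → All (1 ≤_) w → length δ ≡ m → CDT m w ≡ map ℤ.+_ δ → cdes (restrict m w) ≡ sum δ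
cdes-telescope zero    w []  hw _  _ = P.cong cdes (restrict-zero w hw)
cdes-telescope (suc m) w δ hw hl h with snocView δ m hl
... | ds , d , refl , l with LP.∷ʳ-injective (CDT m w) (map ℤ.+_ ds) (P.trans (P.sym (CDT-snoc m w)) (P.trans h (LP.map-++ ℤ.+_ ds [ d ])))
...   | init≡ , last≡ = P.trans (diff≡⇒ _ _ d last≡)
                          (P.trans (P.cong (ℕ._+ d) (cdes-telescope m w ds hw l init≡)) (P.sym (sum-snoc ds d)))

-- Inserting a copies of a letter L into a word u all of whose letters are smaller than L.
-- I u a lists all such insertions, J u a those that do not start with L.

module Insertion (L : ℕ) where

  I J : Word → ℕ → List Word
  I u zero    = J u zero
  I u (suc a) = map (L ∷_) (I u a) ++ J u (suc a)
  J []      zero    = [ [] ]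
  J []      (suc a) = []
  J (x ∷ u) a       = map (x ∷_) (I u a)

  endsWithL : Word → Bool
  endsWithL v = lastLetter v ≡ᵇ L

  record Inserted (u : Word) (a : ℕ) (v : Word) : Set₁ where
    field
      restrict-below : ∀ i → i < L → restrict i v ≡ restrict i u
      count-below    : ∀ j → j < L → count j v ≡ count j u
      count-L        : count L v ≡ a ℕ.+ count L u
      letters        : ∀ {P : ℕ → Set} → P L → All P u → All P v
      nonempty       : v ≡ [] → u ≡ []
      ends-from-[]   : u ≡ [] → v ≡ [] ⊎ lastLetter v ≡ L
      ends           : lastLetter v ≡ L ⊎ lastLetter v ≡ lastLetter u
  open Inserted

  inserted-[] : Inserted [] 0 []
  inserted-[] = record
    { restrict-below = λ _ _ → refl ; count-below = λ _ _ → refl ; count-L = refl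
    ; letters = λ _ _ → [] ; nonempty = λ _ → refl ; ends-from-[] = λ _ → inj₁ refl ; ends = inj₂ refl }

  inserted-L : ∀ {u a v} → Inserted u a v → Inserted u (suc a) (L ∷ v)
  inserted-L {u} {a} {v} h = record
    { restrict-below = λ i i<L → P.trans (restrict-cons i L v)
        (P.trans (P.cong (λ b → if b then L ∷ restrict i v else restrict i v) (≤ᵇ-false i<L)) (restrict-below h i i<L))
    ; count-below = λ j j<L → P.trans (P.cong (λ b → ind b ℕ.+ count j v) (≡ᵇ-false-< j<L)) (count-below h j j<L)
    ; count-L = P.trans (P.cong (λ b → ind b ℕ.+ count L v) (≡ᵇ-refl L)) (P.cong suc (count-L h))
    ; letters = λ pL pu → pL ∷ letters h pL pu
    ; nonempty = λ ()
    ; ends-from-[] = λ u≡[] → inj₂ (ends-of-[] v (ends-from-[] h u≡[]))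
    ; ends = ends-L v (ends h) }
    where
    ends-of-[] : ∀ v → v ≡ [] ⊎ lastLetter v ≡ L → lastLetter (L ∷ v) ≡ L
    ends-of-[] []      _         = refl
    ends-of-[] (y ∷ v) (inj₂ e)  = e
    ends-L : ∀ v → lastLetter v ≡ L ⊎ lastLetter v ≡ lastLetter u → lastLetter (L ∷ v) ≡ L ⊎ lastLetter (L ∷ v) ≡ lastLetter u
    ends-L []      _ = inj₁ refl
    ends-L (y ∷ v) e = e

  inserted-x : ∀ {x u a v} → x < L → Inserted u a v → Inserted (x ∷ u) a (x ∷ v)
  inserted-x {x} {u} {a} {v} x<L h = record
    { restrict-below = λ i i<L → P.trans (restrict-cons i x v)
        (P.trans (P.cong (λ w → if x ≤ᵇ i then x ∷ w else w) (restrict-below h i i<L)) (P.sym (restrict-cons i x u)))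
    ; count-below = λ j j<L → P.cong (ind (j ≡ᵇ x) ℕ.+_) (count-below h j j<L)
    ; count-L = P.trans (P.cong (λ b → ind b ℕ.+ count L v) L≢x)
                  (P.trans (count-L h) (P.sym (P.cong (λ b → a ℕ.+ (ind b ℕ.+ count L u)) L≢x)))
    ; letters = λ pL pu → All.head pu ∷ letters h pL (All.tail pu)
    ; nonempty = λ ()
    ; ends-from-[] = λ ()
    ; ends = ends-x u v (nonempty h) (ends-from-[] h) (ends h) }
    where
    L≢x : (L ≡ᵇ x) ≡ false
    L≢x = ≡ᵇ-false (λ e → NP.<-irrefl (P.sym e) x<L)
    ends-x : ∀ u v → (v ≡ [] → u ≡ []) → (u ≡ [] → v ≡ [] ⊎ lastLetter v ≡ L) →
             lastLetter v ≡ L ⊎ lastLetter v ≡ lastLetter u →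
             lastLetter (x ∷ v) ≡ L ⊎ lastLetter (x ∷ v) ≡ lastLetter (x ∷ u)
    ends-x u       []      empty _     _ with empty refl
    ... | refl = inj₂ refl
    ends-x []      (y ∷ v) _     fromNil _ with fromNil refl
    ... | inj₂ e = inj₁ e
    ends-x (z ∷ u) (y ∷ v) _     _     e = e

  inserted-I : ∀ u a → All (_< L) u → All (Inserted u a) (I u a)
  inserted-J : ∀ u a → All (_< L) u → All (Inserted u a) (J u a)
  inserted-I u zero    hu = inserted-J u zero hu
  inserted-I u (suc a) hu = AllP.++⁺ (AllP.map⁺ (All.map inserted-L (inserted-I u a hu))) (inserted-J u (suc a) hu)
  inserted-J []      zero    hu         = inserted-[] ∷ []
  inserted-J []      (suc a) hu         = []
  inserted-J (x ∷ u) a       (x<L ∷ hu) = AllP.map⁺ (All.map (inserted-x x<L) (inserted-I u a hu))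

  lastLetter<L : ∀ u → 0 < L → All (_< L) u → lastLetter u < L
  lastLetter<L []          0<L _        = 0<L
  lastLetter<L (x ∷ [])    0<L (p ∷ _)  = p
  lastLetter<L (x ∷ y ∷ u) 0<L (_ ∷ ps) = lastLetter<L (y ∷ u) 0<L ps

  lastIs1-inserted : ∀ u v → 2 ≤ L → All (_< L) u → lastLetter v ≡ L ⊎ lastLetter v ≡ lastLetter u →
                     lastIs1 v ≡ lastIs1 u ∧ not (endsWithL v)
  lastIs1-inserted u v 2≤L hu (inj₁ e)
    rewrite lastIs1≡ v | e | ≡ᵇ-refl L | ≡ᵇ-false {L} {1} (λ e' → NP.<-irrefl (P.sym e') 2≤L) = P.sym (BP.∧-zeroʳ _)
  lastIs1-inserted u v 2≤L hu (inj₂ e)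
    rewrite lastIs1≡ v | lastIs1≡ u | e | ≡ᵇ-false-< (lastLetter<L u (NP.<-trans (s≤s z≤n) 2≤L) hu) = P.sym (BP.∧-identityʳ _)

  -- The only insertion into the empty word is Lᵃ, so L ∷ w ends with L for all of them.
  I[]-endsWithL : ∀ a → All (λ w → endsWithL (L ∷ w) ≡ true) (I [] a)
  I[]-endsWithL zero    = ≡ᵇ-refl L ∷ []
  I[]-endsWithL (suc a) = AllP.++⁺ (AllP.map⁺ (I[]-endsWithL a)) []

data AtOrBelow (K e : ℕ) : Set where
  at    : ∀ d → e ≡ K ℕ.+ d → AtOrBelow K e
  below : e < K → AtOrBelow K e

atOrBelow : ∀ K e → AtOrBelow K e
atOrBelow K e with K NP.≤? e
... | yes K≤e = at (e ∸ K) (P.sym (NP.m+[n∸m]≡n K≤e))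
... | no  K≰e = below (NP.≰⇒> K≰e)

module RingKit {c ℓ : Level} (R : CommutativeRing c ℓ) where
  open CommutativeRing R public hiding (zero; refl)
  open CommutativeRing R public using () renaming (refl to ≈-refl)
  open RingDefs R public
  open import Algebra.Solver.Ring.NaturalCoefficients.Default commutativeSemiring public using (solve; _:=_; _:+_; _:*_; con)
  open import Algebra.Properties.CommutativeSemigroup *-commutativeSemigroup public using (x∙yz≈y∙xz)
  open import Algebra.Properties.CommutativeSemiring.Exp commutativeSemiring using (_^_; ^-homo-*; ^-distrib-*)

  ∑ : {A : Set} → (A → Carrier) → List A → Carrier
  ∑ f = foldr (λ w acc → f w + acc) 0#

  ∑-++ : {A : Set} (f : A → Carrier) (xs ys : List A) → ∑ f (xs ++ ys) ≈ ∑ f xs + ∑ f ys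
  ∑-++ f []       ys = sym (+-identityˡ _)
  ∑-++ f (x ∷ xs) ys = trans (+-congˡ (∑-++ f xs ys)) (sym (+-assoc _ _ _))

  ∑-map : {A B : Set} (f : B → Carrier) (g : A → B) (xs : List A) → ∑ f (map g xs) ≡ ∑ (λ x → f (g x)) xs
  ∑-map f g []       = refl
  ∑-map f g (x ∷ xs) = P.cong (f (g x) +_) (∑-map f g xs)

  ∑-concatMap : {A B : Set} (f : B → Carrier) (g : A → List B) (xs : List A) →
                ∑ f (concatMap g xs) ≈ ∑ (λ x → ∑ f (g x)) xs
  ∑-concatMap f g []       = ≈-refl
  ∑-concatMap f g (x ∷ xs) = trans (∑-++ f (g x) (concat (map g xs))) (+-congˡ (∑-concatMap f g xs))

  ∑-cong : {A : Set} {f g : A → Carrier} (xs : List A) → (∀ x → f x ≈ g x) → ∑ f xs ≈ ∑ g xs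
  ∑-cong []       h = ≈-refl
  ∑-cong (x ∷ xs) h = +-cong (h x) (∑-cong xs h)

  ∑-congᴬ : {A : Set} {f g : A → Carrier} {xs : List A} → All (λ x → f x ≈ g x) xs → ∑ f xs ≈ ∑ g xs
  ∑-congᴬ []       = ≈-refl
  ∑-congᴬ (h ∷ hs) = +-cong h (∑-congᴬ hs)

  ∑-+ : {A : Set} (f g : A → Carrier) (xs : List A) → ∑ (λ x → f x + g x) xs ≈ ∑ f xs + ∑ g xs
  ∑-+ f g []       = sym (+-identityˡ _)
  ∑-+ f g (x ∷ xs) = trans (+-congˡ (∑-+ f g xs))
    (solve 4 (λ a b c d → (a :+ b) :+ (c :+ d) := (a :+ c) :+ (b :+ d)) ≈-refl _ _ _ _)

  ∑-*ˡ : {A : Set} (k : Carrier) (f : A → Carrier) (xs : List A) → ∑ (λ x → k * f x) xs ≈ k * ∑ f xs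
  ∑-*ˡ k f []       = sym (zeroʳ k)
  ∑-*ˡ k f (x ∷ xs) = trans (+-congˡ (∑-*ˡ k f xs)) (sym (distribˡ k _ _))

  ∑-*ʳ : {A : Set} (f : A → Carrier) (k : Carrier) (xs : List A) → ∑ (λ x → f x * k) xs ≈ ∑ f xs * k
  ∑-*ʳ f k xs = trans (∑-cong xs (λ x → *-comm _ _)) (trans (∑-*ˡ k f xs) (*-comm _ _))

  ∑-zero : {A : Set} (xs : List A) → ∑ (λ _ → 0#) xs ≈ 0#
  ∑-zero []       = ≈-refl
  ∑-zero (x ∷ xs) = trans (+-identityˡ _) (∑-zero xs)

  ∑-zeroᴬ : {A : Set} {f : A → Carrier} {xs : List A} → All (λ x → f x ≈ 0#) xs → ∑ f xs ≈ 0#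
  ∑-zeroᴬ {xs = xs} h = trans (∑-congᴬ h) (∑-zero xs)

  when : Bool → Carrier → Carrier
  when b x = if b then x else 0#

  ∑-when : ∀ {A : Set} b (g : A → Carrier) xs → ∑ (λ v → when b (g v)) xs ≈ when b (∑ g xs)
  ∑-when true  g xs = ≈-refl
  ∑-when false g xs = ∑-zero xs

  when-cong : ∀ b {x y} → x ≈ y → when b x ≈ when b y
  when-cong true  h = h
  when-cong false h = ≈-refl

  pow≡^ : ∀ x n → pow x n ≡ x ^ n
  pow≡^ x zero    = refl
  pow≡^ x (suc n) = P.cong (x *_) (pow≡^ x n)

  pow-cong : ∀ x {m n} → m ≡ n → pow x m ≈ pow x n
  pow-cong x refl = ≈-refl

  pow-+ : ∀ x m n → pow x (m ℕ.+ n) ≈ pow x m * pow x n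
  pow-+ x m n rewrite pow≡^ x (m ℕ.+ n) | pow≡^ x m | pow≡^ x n = ^-homo-* x m n

  pow-inverse : ∀ q q⁻ → q * q⁻ ≈ 1# → ∀ n → pow q n * pow q⁻ n ≈ 1#
  pow-inverse q q⁻ inv n rewrite pow≡^ q n | pow≡^ q⁻ n = trans (sym (^-distrib-* q q⁻ n)) (ones n)
    where
    ones : ∀ n → (q * q⁻) ^ n ≈ 1#
    ones zero    = ≈-refl
    ones (suc n) = trans (*-cong inv (ones n)) (*-identityˡ _)

module QSymmetric {c ℓ : Level} (R : CommutativeRing c ℓ) (q : CommutativeRing.Carrier R) where
  open RingKit R

  E : ℕ → ℕ → Carrier
  E d M = esym d (powers q M)

  H : ℕ → ℕ → Carrier
  H j S = hsym j (powers q S)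

  H∸ : ℕ → ℕ → ℕ → Carrier
  H∸ a d S = if d ≤ᵇ a then H (a ∸ d) S else 0#

  H∸-suc : ∀ a d S → H∸ (suc a) (suc d) S ≡ H∸ a d S
  H∸-suc a zero    S = refl
  H∸-suc a (suc d) S = refl

  powers-cons : ∀ M → powers q (suc M) ≡ 1# ∷ map (q *_) (powers q M)
  powers-cons M = P.cong (1# ∷_) (P.trans (LP.map-applyUpTo suc (pow q) M)
    (P.sym (P.trans (P.cong (map (q *_)) (LP.map-applyUpTo (λ x → x) (pow q) M)) (LP.map-applyUpTo (pow q) (q *_) M))))

  powers-snoc : ∀ M → powers q (suc M) ≡ powers q M ++ [ pow q M ]
  powers-snoc M = map-upTo-snoc (pow q) M

  esym-scale : ∀ (k : Carrier) d xs → esym d (map (k *_) xs) ≈ pow k d * esym d xs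
  esym-scale k zero    xs       = sym (*-identityˡ _)
  esym-scale k (suc d) []       = sym (zeroʳ _)
  esym-scale k (suc d) (x ∷ xs) = trans (+-cong (*-congˡ (esym-scale k d xs)) (esym-scale k (suc d) xs))
    (solve 5 (λ k x kd e1 e2 → (k :* x) :* (kd :* e1) :+ (k :* kd) :* e2 := (k :* kd) :* (x :* e1 :+ e2)) ≈-refl k x (pow k d) _ _)

  hsym-scale : ∀ (k : Carrier) d xs → hsym d (map (k *_) xs) ≈ pow k d * hsym d xs
  hsym-scale k zero    xs       = sym (*-identityˡ _)
  hsym-scale k (suc d) []       = sym (zeroʳ _)
  hsym-scale k (suc d) (x ∷ xs) = trans (+-cong (*-congˡ (hsym-scale k d (x ∷ xs))) (hsym-scale k (suc d) xs))
    (solve 5 (λ k x kd e1 e2 → (k :* x) :* (kd :* e1) :+ (k :* kd) :* e2 := (k :* kd) :* (x :* e1 :+ e2)) ≈-refl k x (pow k d) _ _)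

  hsym-snoc : ∀ j xs y → hsym (suc j) (xs ++ [ y ]) ≈ hsym (suc j) xs + y * hsym j (xs ++ [ y ])
  hsym-snoc j       []       y = +-comm _ _
  hsym-snoc zero    (x ∷ xs) y = trans (+-congˡ (hsym-snoc zero xs y)) (sym (+-assoc _ _ _))
  hsym-snoc (suc j) (x ∷ xs) y = trans (+-cong (*-congˡ (hsym-snoc j (x ∷ xs) y)) (hsym-snoc (suc j) xs y))
    (solve 6 (λ x y A B C D → x :* (A :+ y :* B) :+ (C :+ y :* D) := (x :* A :+ C) :+ y :* (x :* B :+ D)) ≈-refl x y _ _ _ _)

  E-pascal : ∀ d M → E (suc d) (suc M) ≈ pow q d * E d M + pow q (suc d) * E (suc d) M
  E-pascal d M = trans (reflexive (P.cong (esym (suc d)) (powers-cons M)))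
    (+-cong (trans (*-identityˡ _) (esym-scale q d (powers q M))) (esym-scale q (suc d) (powers q M)))

  H-pascal : ∀ j S → H (suc j) (suc S) ≈ pow q S * H j (suc S) + H (suc j) S
  H-pascal j S = trans (reflexive (P.cong (hsym (suc j)) (powers-snoc S)))
    (trans (hsym-snoc j (powers q S) (pow q S))
      (trans (+-comm _ _) (+-congʳ (*-congˡ (reflexive (P.cong (hsym j) (P.sym (powers-snoc S))))))))

  H∸-pascal : ∀ a d S → H∸ (suc a) d (suc S) ≈ pow q S * H∸ a d (suc S) + H∸ (suc a) d S
  H∸-pascal a d S with NP.<-cmp d (suc a)
  ... | tri< d<1+a _ _
      rewrite ≤ᵇ-true (NP.<⇒≤ d<1+a) | ≤ᵇ-true (NP.≤-pred d<1+a) | NP.+-∸-assoc 1 (NP.≤-pred d<1+a) = H-pascal (a ∸ d) S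
  ... | tri≈ _ refl _
      rewrite ≤ᵇ-true (NP.≤-refl {suc a}) | ≤ᵇ-false (NP.≤-refl {suc a}) | NP.n∸n≡0 a =
      sym (trans (+-congʳ (zeroʳ _)) (+-identityˡ _))
  ... | tri> _ _ 1+a<d
      rewrite ≤ᵇ-false 1+a<d | ≤ᵇ-false (NP.<-trans (NP.n<1+n a) 1+a<d) =
      sym (trans (+-congʳ (zeroʳ _)) (+-identityˡ _))

-- For a word u with K descents and length K + 1 + M
-- and an increase d of the descent number, the weighted sums over the insertions of a
-- letters L that do not end with L are q^maj(u) times
--   gfJ: insertions starting with the first letter of u,
--   gfL: insertions of the form L v (v an insertion of a letters),
--   gfI: all insertions.

module ClosedForms {c ℓ : Level} (R : CommutativeRing c ℓ) (q : CommutativeRing.Carrier R) where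
  open RingKit R
  open SetoidReasoning setoid
  open QSymmetric R q

  gfJ gfL gfI : ℕ → ℕ → ℕ → ℕ → Carrier
  gfJ K M a d       = pow q (d ℕ.* K ℕ.+ d C 2 ℕ.+ a ℕ.+ d) * E d M * H∸ a d (K ℕ.+ d)
  gfL K M a zero    = 0#
  gfL K M a (suc d) = pow q (suc d ℕ.* K ℕ.+ suc d C 2 ℕ.+ suc a ℕ.+ d) * E d M * H∸ a d (K ℕ.+ suc d)
  gfI K M a d       = pow q (d ℕ.* K ℕ.+ d C 2 ℕ.+ a) * E d (suc M) * H∸ a d (K ℕ.+ d)

  pow-merge : ∀ a b c → a ℕ.+ b ≡ c → pow q a * pow q b ≈ pow q c
  pow-merge a b c h = trans (sym (pow-+ q a b)) (pow-cong q h)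

  pow-regroup : ∀ a b c d → a ℕ.+ b ≡ c ℕ.+ d → pow q a * pow q b ≈ pow q c * pow q d
  pow-regroup a b c d h = trans (pow-merge a b _ h) (pow-+ q c d)

  pow-regroup₃ : ∀ a b c d e → a ℕ.+ b ≡ c ℕ.+ d ℕ.+ e → pow q a * pow q b ≈ pow q c * pow q d * pow q e
  pow-regroup₃ a b c d e h = trans (pow-merge a b _ h) (trans (pow-+ q (c ℕ.+ d) e) (*-congʳ (pow-+ q c d)))

  scale-terms : ∀ p x y e h1 h2 → p * (x * e * h1 + y * e * h2) ≈ (p * x) * e * h1 + (p * y) * e * h2
  scale-terms = solve 6 (λ p x y e h1 h2 → p :* (x :* e :* h1 :+ y :* e :* h2) := (p :* x) :* e :* h1 :+ (p :* y) :* e :* h2) ≈-refl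
  expand-H : ∀ z e s h1 h2 → z * e * (s * h1 + h2) ≈ (z * s) * e * h1 + z * e * h2
  expand-H = solve 5 (λ z e s h1 h2 → z :* e :* (s :* h1 :+ h2) := (z :* s) :* e :* h1 :+ z :* e :* h2) ≈-refl
  scale-expand-H : ∀ p z e s h1 h2 → p * (z * e * (s * h1 + h2)) ≈ (p * z * s) * e * h1 + (p * z) * e * h2
  scale-expand-H = solve 6 (λ p z e s h1 h2 → p :* (z :* e :* (s :* h1 :+ h2)) := (p :* z :* s) :* e :* h1 :+ (p :* z) :* e :* h2) ≈-refl
  expand-E : ∀ z x e1 y e2 h → z * (x * e1 + y * e2) * h ≈ (z * x) * e1 * h + (z * y) * e2 * h
  expand-E = solve 6 (λ z x e1 y e2 h → z :* (x :* e1 :+ y :* e2) :* h := (z :* x) :* e1 :* h :+ (z :* y) :* e2 :* h) ≈-refl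
  absorb-power : ∀ p z e h → p * (z * e * h) ≈ (p * z) * e * h
  absorb-power = solve 4 (λ p z e h → p :* (z :* e :* h) := (p :* z) :* e :* h) ≈-refl
  zero-last : ∀ p x e → p * (x * e * 0#) ≈ 0#
  zero-last p x e = trans (*-congˡ (zeroʳ _)) (zeroʳ _)

  -- An insertion of a+1 letters L starts either with L or with the first letter of u.
  gfI-suc : ∀ K M a d → gfL K M a d + gfJ K M (suc a) d ≈ gfI K M (suc a) d
  gfI-suc K M a zero = trans (+-identityˡ _) (*-congʳ (*-congʳ (pow-cong q (NP.+-identityʳ (suc a)))))
  gfI-suc K M a (suc d) = sym (begin
     gfI K M (suc a) (suc d)
       ≈⟨ *-congʳ (*-congˡ (E-pascal d M)) ⟩
     pow q Z * (pow q d * E d M + pow q (suc d) * E (suc d) M) * H∸ (suc a) (suc d) (K ℕ.+ suc d)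
       ≈⟨ expand-E _ _ _ _ _ _ ⟩
     (pow q Z * pow q d) * E d M * H∸ (suc a) (suc d) (K ℕ.+ suc d) + (pow q Z * pow q (suc d)) * E (suc d) M * H∸ (suc a) (suc d) (K ℕ.+ suc d)
       ≈⟨ +-cong (*-cong (*-congʳ (sym (pow-+ q Z d))) (reflexive (H∸-suc a d _))) (*-congʳ (*-congʳ (sym (pow-+ q Z (suc d))))) ⟩
     gfL K M a (suc d) + gfJ K M (suc a) (suc d) ∎)
    where
    Z : ℕ
    Z = suc d ℕ.* K ℕ.+ suc d C 2 ℕ.+ suc a

  -- Prepending a letter that is not a descent: maj grows by the descent count, M by one.
  gfI-ascent : ∀ K M a d → pow q (K ℕ.+ d) * gfI K M a d ≈ pow q K * gfJ K (suc M) a d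
  gfI-ascent K M a d = trans (absorb-power _ _ _ _)
    (trans (*-congʳ (*-congʳ (pow-regroup (K ℕ.+ d) Z K (Z ℕ.+ d) (exponent K d Z)))) (sym (absorb-power _ _ _ _)))
    where
    Z : ℕ
    Z = d ℕ.* K ℕ.+ d C 2 ℕ.+ a
    exponent : ∀ K d Z → K ℕ.+ d ℕ.+ Z ≡ K ℕ.+ (Z ℕ.+ d)
    exponent = solve-∀

  -- With no letter L to insert, every insertion starts with the first letter of u.
  gfI-zero : ∀ K M d → gfJ K M 0 d ≈ gfI K M 0 d
  gfI-zero K M zero = ≈-refl
  gfI-zero K M (suc d) = trans (zeroʳ _) (sym (zeroʳ _))

  -- Prepending a letter that creates a descent: K grows by one.
  gfJ-descent : ∀ K M a d → pow q (suc K ℕ.+ d) * (gfL K M a (suc d) + gfJ K M (suc a) d)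
                          ≈ pow q (suc K) * gfJ (suc K) M (suc a) d
  gfJ-descent K M a d = begin
     pow q (suc K ℕ.+ d) * (gfL K M a (suc d) + gfJ K M (suc a) d)
       ≈⟨ *-congˡ (+-congʳ (*-congˡ (reflexive (P.cong (H∸ a d) (NP.+-suc K d))))) ⟩
     pow q (suc K ℕ.+ d) * (pow q X * E d M * h1 + pow q Y * E d M * h2)
       ≈⟨ scale-terms _ _ _ _ _ _ ⟩
     (pow q (suc K ℕ.+ d) * pow q X) * E d M * h1 + (pow q (suc K ℕ.+ d) * pow q Y) * E d M * h2
       ≈⟨ +-cong (*-congʳ (*-congʳ (pow-regroup₃ (suc K ℕ.+ d) X (suc K) Z (K ℕ.+ d) exponent-X)))
                 (*-congʳ (*-congʳ (pow-regroup (suc K ℕ.+ d) Y (suc K) Z (exponent₂ K d a (d C 2))))) ⟩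
     (pow q (suc K) * pow q Z * pow q (K ℕ.+ d)) * E d M * h1 + (pow q (suc K) * pow q Z) * E d M * h2
       ≈⟨ sym (scale-expand-H _ _ _ _ _ _) ⟩
     pow q (suc K) * (pow q Z * E d M * (pow q (K ℕ.+ d) * h1 + h2))
       ≈⟨ *-congˡ (*-congˡ (sym (H∸-pascal a d (K ℕ.+ d)))) ⟩
     pow q (suc K) * gfJ (suc K) M (suc a) d ∎
    where
    X Y Z : ℕ
    X = suc d ℕ.* K ℕ.+ suc d C 2 ℕ.+ suc a ℕ.+ d
    Y = d ℕ.* K ℕ.+ d C 2 ℕ.+ suc a ℕ.+ d
    Z = d ℕ.* suc K ℕ.+ d C 2 ℕ.+ suc a ℕ.+ d
    h1 h2 : Carrier
    h1 = H∸ a d (suc (K ℕ.+ d))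
    h2 = H∸ (suc a) d (K ℕ.+ d)
    exponent₁ : ∀ K d a c → suc K ℕ.+ d ℕ.+ (suc d ℕ.* K ℕ.+ (c ℕ.+ d) ℕ.+ suc a ℕ.+ d)
                            ≡ suc K ℕ.+ (d ℕ.* suc K ℕ.+ c ℕ.+ suc a ℕ.+ d) ℕ.+ (K ℕ.+ d)
    exponent₁ = solve-∀
    exponent₂ : ∀ K d a c → suc K ℕ.+ d ℕ.+ (d ℕ.* K ℕ.+ c ℕ.+ suc a ℕ.+ d) ≡ suc K ℕ.+ (d ℕ.* suc K ℕ.+ c ℕ.+ suc a ℕ.+ d)
    exponent₂ = solve-∀
    exponent-X : suc K ℕ.+ d ℕ.+ X ≡ suc K ℕ.+ Z ℕ.+ (K ℕ.+ d)
    exponent-X = P.trans (P.cong (λ w → suc K ℕ.+ d ℕ.+ (suc d ℕ.* K ℕ.+ w ℕ.+ suc a ℕ.+ d)) (C2-suc d)) (exponent₁ K d a (d C 2))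

  gfJ-descent-zero : ∀ K M d → pow q (suc K ℕ.+ d) * gfJ K M 0 d ≈ pow q (suc K) * gfJ (suc K) M 0 d
  gfJ-descent-zero K M zero = *-congʳ (pow-cong q (NP.+-identityʳ (suc K)))
  gfJ-descent-zero K M (suc d) = trans (zero-last _ _ _) (sym (zero-last _ _ _))

  -- A word L v with v an insertion of a+1 letters: the leading L is a descent.
  gfL-suc : ∀ K M a d → gfL K M (suc a) (suc d)
                      ≈ pow q (K ℕ.+ suc d) * (gfL K M a (suc d) + gfJ K M (suc a) d)
  gfL-suc K M a d = begin
     gfL K M (suc a) (suc d)
       ≈⟨ *-congˡ (reflexive (P.cong (H∸ (suc a) d) (NP.+-suc K d))) ⟩
     pow q X1 * E d M * H∸ (suc a) d (suc (K ℕ.+ d))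
       ≈⟨ *-congˡ (H∸-pascal a d (K ℕ.+ d)) ⟩
     pow q X1 * E d M * (pow q (K ℕ.+ d) * h1 + h2)
       ≈⟨ expand-H _ _ _ _ _ ⟩
     (pow q X1 * pow q (K ℕ.+ d)) * E d M * h1 + pow q X1 * E d M * h2
       ≈⟨ +-cong (*-congʳ (*-congʳ (pow-regroup X1 (K ℕ.+ d) (K ℕ.+ suc d) X2 exponent-X2)))
                 (*-congʳ (*-congʳ (sym (pow-merge (K ℕ.+ suc d) X3 X1 exponent-X3)))) ⟩
     (pow q (K ℕ.+ suc d) * pow q X2) * E d M * h1 + (pow q (K ℕ.+ suc d) * pow q X3) * E d M * h2
       ≈⟨ sym (scale-terms _ _ _ _ _ _) ⟩
     pow q (K ℕ.+ suc d) * (pow q X2 * E d M * h1 + pow q X3 * E d M * h2)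
       ≈⟨ *-congˡ (+-congʳ (*-congˡ (reflexive (P.cong (H∸ a d) (P.sym (NP.+-suc K d)))))) ⟩
     pow q (K ℕ.+ suc d) * (gfL K M a (suc d) + gfJ K M (suc a) d) ∎
    where
    X1 X2 X3 : ℕ
    X1 = suc d ℕ.* K ℕ.+ suc d C 2 ℕ.+ suc (suc a) ℕ.+ d
    X2 = suc d ℕ.* K ℕ.+ suc d C 2 ℕ.+ suc a ℕ.+ d
    X3 = d ℕ.* K ℕ.+ d C 2 ℕ.+ suc a ℕ.+ d
    h1 h2 : Carrier
    h1 = H∸ a d (suc (K ℕ.+ d))
    h2 = H∸ (suc a) d (K ℕ.+ d)
    exponent₁ : ∀ K d a c → suc d ℕ.* K ℕ.+ (c ℕ.+ d) ℕ.+ suc (suc a) ℕ.+ d ℕ.+ (K ℕ.+ d)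
                            ≡ K ℕ.+ suc d ℕ.+ (suc d ℕ.* K ℕ.+ (c ℕ.+ d) ℕ.+ suc a ℕ.+ d)
    exponent₁ = solve-∀
    exponent₂ : ∀ K d a c → suc d ℕ.* K ℕ.+ (c ℕ.+ d) ℕ.+ suc (suc a) ℕ.+ d ≡ K ℕ.+ suc d ℕ.+ (d ℕ.* K ℕ.+ c ℕ.+ suc a ℕ.+ d)
    exponent₂ = solve-∀
    -- The occurrences of (d+1 choose 2) are unfolded to (d choose 2) + d for the solver.
    exponent-X2 : X1 ℕ.+ (K ℕ.+ d) ≡ K ℕ.+ suc d ℕ.+ X2
    exponent-X2 = P.trans (P.cong (λ w → suc d ℕ.* K ℕ.+ w ℕ.+ suc (suc a) ℕ.+ d ℕ.+ (K ℕ.+ d)) (C2-suc d))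
      (P.trans (exponent₁ K d a (d C 2)) (P.cong (λ w → K ℕ.+ suc d ℕ.+ (suc d ℕ.* K ℕ.+ w ℕ.+ suc a ℕ.+ d)) (P.sym (C2-suc d))))
    exponent-X3 : K ℕ.+ suc d ℕ.+ X3 ≡ X1
    exponent-X3 = P.sym (P.trans (P.cong (λ w → suc d ℕ.* K ℕ.+ w ℕ.+ suc (suc a) ℕ.+ d) (C2-suc d)) (exponent₂ K d a (d C 2)))

  gfL-one : ∀ K M d → gfL K M 0 (suc d) ≈ pow q (K ℕ.+ suc d) * gfJ K M 0 d
  gfL-one K M zero    = trans (*-congʳ (*-congʳ (pow-cong q (exponent K))))
                          (solve 1 (λ p → p :* con 1 :* con 1 := p :* (con 1 :* con 1 :* con 1)) ≈-refl _)
    where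
    exponent : ∀ K → 1 ℕ.* K ℕ.+ 0 ℕ.+ 1 ℕ.+ 0 ≡ K ℕ.+ 1
    exponent = solve-∀
  gfL-one K M (suc d) = trans (zeroʳ _) (sym (zero-last _ _ _))

  -- The closed forms as functions of the total descent number e of the insertion:
  -- shifted K F e = F (e - K) for e ≥ K and 0 for e < K.
  shifted : ℕ → (ℕ → Carrier) → ℕ → Carrier
  shifted K F e = if K ≤ᵇ e then F (e ∸ K) else 0#

  shifted-at : ∀ K F d → shifted K F (K ℕ.+ d) ≈ F d
  shifted-at K F d rewrite ≤ᵇ-true (NP.m≤m+n K d) | NP.m+n∸m≡n K d = ≈-refl

  shifted-at-suc : ∀ K F d → shifted K F (suc (K ℕ.+ d)) ≈ F (suc d)
  shifted-at-suc K F d = trans (reflexive (P.cong (shifted K F) (P.sym (NP.+-suc K d)))) (shifted-at K F (suc d))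

  shifted-below : ∀ K F e → e < K → shifted K F e ≈ 0#
  shifted-below K F e e<K rewrite ≤ᵇ-false e<K = ≈-refl

  -- A word starting with L has a descent there, so gfL vanishes at e ≤ K.
  shifted-gfL-≤ : ∀ K M a e → e ≤ K → shifted K (gfL K M a) e ≈ 0#
  shifted-gfL-≤ K M a e e≤K with NP.m≤n⇒m<n∨m≡n e≤K
  ... | inj₁ e<K = shifted-below K (gfL K M a) e e<K
  ... | inj₂ refl = trans (reflexive (P.cong (shifted K (gfL K M a)) (P.sym (NP.+-identityʳ K)))) (shifted-at K (gfL K M a) 0)

  -- Each is proved by
  -- comparing e with K: at e = K + d it is the corresponding unshifted identity, below K
  -- every term vanishes.

  all-zero : ∀ K M e → shifted K (gfJ K M 0) e ≈ shifted K (gfI K M 0) e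
  all-zero K M e with atOrBelow K e
  ... | at d refl = trans (shifted-at K (gfJ K M 0) d) (trans (gfI-zero K M d) (sym (shifted-at K (gfI K M 0) d)))
  ... | below e<K = trans (shifted-below K (gfJ K M 0) e e<K) (sym (shifted-below K (gfI K M 0) e e<K))

  all-suc : ∀ K M a e → shifted K (gfL K M a) e + shifted K (gfJ K M (suc a)) e ≈ shifted K (gfI K M (suc a)) e
  all-suc K M a e with atOrBelow K e
  ... | at d refl = trans (+-cong (shifted-at K (gfL K M a) d) (shifted-at K (gfJ K M (suc a)) d))
                      (trans (gfI-suc K M a d) (sym (shifted-at K (gfI K M (suc a)) d)))
  ... | below e<K = trans (+-cong (shifted-below K (gfL K M a) e e<K) (shifted-below K (gfJ K M (suc a)) e e<K))
                      (trans (+-identityˡ _) (sym (shifted-below K (gfI K M (suc a)) e e<K)))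

  -- Prepending a letter without creating a descent (to any insertion into u).
  ascent : ∀ K M a e → pow q e * shifted K (gfI K M a) e ≈ pow q K * shifted K (gfJ K (suc M) a) e
  ascent K M a e with atOrBelow K e
  ... | at d refl = trans (*-congˡ (shifted-at K (gfI K M a) d))
                      (trans (gfI-ascent K M a d) (*-congˡ (sym (shifted-at K (gfJ K (suc M) a) d))))
  ... | below e<K = trans (*-congˡ (shifted-below K (gfI K M a) e e<K))
                      (trans (zeroʳ _) (sym (trans (*-congˡ (shifted-below K (gfJ K (suc M) a) e e<K)) (zeroʳ _))))

  -- Prepending a letter that is a descent before the first letter of u and an ascent before L.
  descent-zero : ∀ K M e → pow q (suc e) * shifted K (gfJ K M 0) e ≈ pow q (suc K) * shifted (suc K) (gfJ (suc K) M 0) (suc e)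
  descent-zero K M e with atOrBelow K e
  ... | at d refl = trans (*-congˡ (shifted-at K (gfJ K M 0) d))
                      (trans (gfJ-descent-zero K M d) (*-congˡ (sym (shifted-at (suc K) (gfJ (suc K) M 0) d))))
  ... | below e<K = trans (*-congˡ (shifted-below K (gfJ K M 0) e e<K))
                      (trans (zeroʳ _) (sym (trans (*-congˡ (shifted-below (suc K) (gfJ (suc K) M 0) (suc e) (s≤s e<K))) (zeroʳ _))))

  descent-suc : ∀ K M a e → pow q (suc e) * (shifted K (gfL K M a) (suc e) + shifted K (gfJ K M (suc a)) e)
                            ≈ pow q (suc K) * shifted (suc K) (gfJ (suc K) M (suc a)) (suc e)
  descent-suc K M a e with atOrBelow K e
  ... | at d refl = trans (*-congˡ (+-cong (shifted-at-suc K (gfL K M a) d) (shifted-at K (gfJ K M (suc a)) d)))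
                      (trans (gfJ-descent K M a d) (*-congˡ (sym (shifted-at (suc K) (gfJ (suc K) M (suc a)) d))))
  ... | below e<K = trans (*-congˡ (trans (+-cong (shifted-gfL-≤ K M a (suc e) e<K) (shifted-below K (gfJ K M (suc a)) e e<K)) (+-identityˡ _)))
                      (trans (zeroʳ _) (sym (trans (*-congˡ (shifted-below (suc K) (gfJ (suc K) M (suc a)) (suc e) (s≤s e<K))) (zeroʳ _))))

  leadL-zero : ∀ K M e → pow q (suc e) * shifted K (gfJ K M 0) e ≈ shifted K (gfL K M 0) (suc e)
  leadL-zero K M e with atOrBelow K e
  ... | at d refl = trans (*-congˡ (shifted-at K (gfJ K M 0) d))
                      (trans (sym (trans (gfL-one K M d) (*-congʳ (pow-cong q (NP.+-suc K d))))) (sym (shifted-at-suc K (gfL K M 0) d)))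
  ... | below e<K = trans (*-congˡ (shifted-below K (gfJ K M 0) e e<K)) (trans (zeroʳ _) (sym (shifted-gfL-≤ K M 0 (suc e) e<K)))

  leadL-suc : ∀ K M a e → pow q (suc e) * (shifted K (gfL K M a) (suc e) + shifted K (gfJ K M (suc a)) e)
                          ≈ shifted K (gfL K M (suc a)) (suc e)
  leadL-suc K M a e with atOrBelow K e
  ... | at d refl = trans (*-congˡ (+-cong (shifted-at-suc K (gfL K M a) d) (shifted-at K (gfJ K M (suc a)) d)))
                      (trans (sym (trans (gfL-suc K M a d) (*-congʳ (pow-cong q (NP.+-suc K d))))) (sym (shifted-at-suc K (gfL K M (suc a)) d)))
  ... | below e<K = trans (*-congˡ (trans (+-cong (shifted-gfL-≤ K M a (suc e) e<K) (shifted-below K (gfJ K M (suc a)) e e<K)) (+-identityˡ _)))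
                      (trans (zeroʳ _) (sym (shifted-gfL-≤ K M (suc a) (suc e) e<K)))

module InsertionSums {c ℓ : Level} (R : CommutativeRing c ℓ) (L : ℕ) where
  open RingKit R
  open Insertion L

  ∑-cons : ∀ x (X : List Word) (f : Word → Carrier) → ∑ f (map (x ∷_) X) ≡ ∑ (λ w → f (x ∷ w)) X
  ∑-cons x X f = ∑-map f (x ∷_) X

  ∑-I-suc : ∀ u a (f : Word → Carrier) → ∑ f (I u (suc a)) ≈ ∑ (λ w → f (L ∷ w)) (I u a) + ∑ f (J u (suc a))
  ∑-I-suc u a f = trans (∑-++ f (map (L ∷_) (I u a)) (J u (suc a))) (+-congʳ (reflexive (∑-cons L (I u a) f)))

module InsertionSum {c ℓ : Level} (R : CommutativeRing c ℓ) (q : CommutativeRing.Carrier R) (L : ℕ) where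
  open RingKit R
  open SetoidReasoning setoid
  open ClosedForms R q
  open Insertion L
  open InsertionSums R L

  weightIf : Bool → Word → Carrier
  weightIf b v = if b ∧ not (endsWithL v) then pow q (maj v) else 0#

  weight : ℕ → Word → Carrier
  weight e v = weightIf (des v ≡ᵇ e) v

  sumJ sumL sumI : Word → ℕ → ℕ → Carrier
  sumJ u a e = ∑ (weight e) (J u a)
  sumL u a e = ∑ (λ v → weight e (L ∷ v)) (I u a)
  sumI u a e = ∑ (weight e) (I u a)

  -- Prepending x to h w: maj grows by des(x h w), which moves the weight to q^e.
  weight-cons : ∀ x h w e → weight e (x ∷ h ∷ w) ≈ pow q e * weightIf (des (x ∷ h ∷ w) ≡ᵇ e) (h ∷ w)
  weight-cons x h w e rewrite maj-cons x h w = shift (ind (h <ᵇ x)) (des (h ∷ w)) (maj (h ∷ w)) (not (endsWithL (h ∷ w)))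
    where
    shift : ∀ t D m b → (if ((t ℕ.+ D) ≡ᵇ e) ∧ b then pow q (t ℕ.+ (m ℕ.+ D)) else 0#)
                        ≈ pow q e * (if ((t ℕ.+ D) ≡ᵇ e) ∧ b then pow q m else 0#)
    shift t D m b with (t ℕ.+ D) ≡ᵇ e in eq | b
    ... | false | _     = sym (zeroʳ _)
    ... | true  | false = sym (zeroʳ _)
    ... | true  | true  = trans (pow-cong q exponent) (pow-+ q e m)
      where
      exponent : t ℕ.+ (m ℕ.+ D) ≡ e ℕ.+ m
      exponent = P.trans (P.cong (t ℕ.+_) (NP.+-comm m D))
                   (P.trans (P.sym (NP.+-assoc t D m)) (P.cong (ℕ._+ m) (NP.≡ᵇ⇒≡ _ _ (true⇒T eq))))

  ∑-ascent : ∀ x h (X : List Word) e → (h <ᵇ x) ≡ false →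
             ∑ (λ w → weight e (x ∷ h ∷ w)) X ≈ pow q e * ∑ (λ w → weight e (h ∷ w)) X
  ∑-ascent x h X e h≮x = trans (∑-cong X (λ w → trans (weight-cons x h w e)
      (*-congˡ (reflexive (P.cong (λ b → weightIf ((ind b ℕ.+ des (h ∷ w)) ≡ᵇ e) (h ∷ w)) h≮x)))))
    (∑-*ˡ (pow q e) _ X)

  ∑-descent : ∀ x h (X : List Word) e → (h <ᵇ x) ≡ true →
              ∑ (λ w → weight (suc e) (x ∷ h ∷ w)) X ≈ pow q (suc e) * ∑ (λ w → weight e (h ∷ w)) X
  ∑-descent x h X e h<x = trans (∑-cong X (λ w → trans (weight-cons x h w (suc e))
      (*-congˡ (reflexive (P.cong (λ b → weightIf ((ind b ℕ.+ des (h ∷ w)) ≡ᵇ suc e) (h ∷ w)) h<x)))))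
    (∑-*ˡ (pow q (suc e)) _ X)

  ∑-descent-0 : ∀ x h (X : List Word) → (h <ᵇ x) ≡ true → ∑ (λ w → weight 0 (x ∷ h ∷ w)) X ≈ 0#
  ∑-descent-0 x h X h<x = ∑-zeroᴬ {xs = X} (All.tabulate (λ {w} _ → trans (weight-cons x h w 0)
      (trans (*-congˡ (reflexive (P.cong (λ b → weightIf ((ind b ℕ.+ des (h ∷ w)) ≡ᵇ 0) (h ∷ w)) h<x))) (zeroʳ _))))

  -- Prepending x ≤ y to the insertions into y u creates no descent (their first letter is y or L).
  ∑-prepend-ascent-J : ∀ x y u a e → (y <ᵇ x) ≡ false →
                       ∑ (λ v → weight e (x ∷ v)) (J (y ∷ u) a) ≈ pow q e * sumJ (y ∷ u) a e
  ∑-prepend-ascent-J x y u a e y≮x =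
    trans (reflexive (∑-cons y (I u a) (λ v → weight e (x ∷ v))))
      (trans (∑-ascent x y (I u a) e y≮x) (*-congˡ (reflexive (P.sym (∑-cons y (I u a) (weight e))))))

  ∑-prepend-ascent : ∀ x y u a e → (y <ᵇ x) ≡ false → (L <ᵇ x) ≡ false →
                     ∑ (λ v → weight e (x ∷ v)) (I (y ∷ u) a) ≈ pow q e * sumI (y ∷ u) a e
  ∑-prepend-ascent x y u zero    e y≮x L≮x = ∑-prepend-ascent-J x y u 0 e y≮x
  ∑-prepend-ascent x y u (suc a) e y≮x L≮x = begin
    ∑ (λ v → weight e (x ∷ v)) (I (y ∷ u) (suc a))
      ≈⟨ ∑-I-suc (y ∷ u) a (λ v → weight e (x ∷ v)) ⟩
    ∑ (λ w → weight e (x ∷ L ∷ w)) (I (y ∷ u) a) + ∑ (λ v → weight e (x ∷ v)) (J (y ∷ u) (suc a))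
      ≈⟨ +-cong (∑-ascent x L (I (y ∷ u) a) e L≮x) (∑-prepend-ascent-J x y u (suc a) e y≮x) ⟩
    pow q e * sumL (y ∷ u) a e + pow q e * sumJ (y ∷ u) (suc a) e
      ≈⟨ sym (distribˡ _ _ _) ⟩
    pow q e * (sumL (y ∷ u) a e + sumJ (y ∷ u) (suc a) e)
      ≈⟨ *-congˡ (sym (∑-I-suc (y ∷ u) a (weight e))) ⟩
    pow q e * sumI (y ∷ u) (suc a) e ∎

  -- Prepending z with y < z ≤ L to the insertions into y u: a descent before y, none before L.
  ∑-prepend-descent-J : ∀ z y u a e → (y <ᵇ z) ≡ true →
                        ∑ (λ v → weight (suc e) (z ∷ v)) (J (y ∷ u) a) ≈ pow q (suc e) * sumJ (y ∷ u) a e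
  ∑-prepend-descent-J z y u a e y<z =
    trans (reflexive (∑-cons y (I u a) (λ v → weight (suc e) (z ∷ v))))
      (trans (∑-descent z y (I u a) e y<z) (*-congˡ (reflexive (P.sym (∑-cons y (I u a) (weight e))))))

  ∑-prepend-descent-J-0 : ∀ z y u a → (y <ᵇ z) ≡ true → ∑ (λ v → weight 0 (z ∷ v)) (J (y ∷ u) a) ≈ 0#
  ∑-prepend-descent-J-0 z y u a y<z =
    trans (reflexive (∑-cons y (I u a) (λ v → weight 0 (z ∷ v)))) (∑-descent-0 z y (I u a) y<z)

  ∑-prepend-L : ∀ z w a e → (L <ᵇ z) ≡ false →
                ∑ (λ v → weight e (z ∷ L ∷ v)) (I w a) ≈ pow q e * sumL w a e
  ∑-prepend-L z w a e L≮z = ∑-ascent z L (I w a) e L≮z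

  Closes : (Word → ℕ → ℕ → Carrier) → (ℕ → ℕ → ℕ → ℕ → Carrier) → Word → ℕ → Set ℓ
  Closes S gf u M = ∀ a e → S u a e ≈ pow q (maj u) * shifted (des u) (gf (des u) M a) e

  Shape : Word → ℕ → Set
  Shape u M = All (_< L) u × length u ≡ des u ℕ.+ suc M

  pow-maj : ∀ n m K Y → n ≡ m ℕ.+ K → pow q m * (pow q K * Y) ≈ pow q n * Y
  pow-maj n m K Y h = trans (sym (*-assoc _ _ _)) (*-congʳ (trans (sym (pow-+ q m K)) (pow-cong q (P.sym h))))

  pow-maj-descent : ∀ y u {Y} → pow q (maj (y ∷ u)) * (pow q (suc (des (y ∷ u))) * Y) ≈ pow q (suc (majFrom 2 (y ∷ u))) * Y
  pow-maj-descent y u = pow-maj _ (maj (y ∷ u)) (suc (des (y ∷ u))) _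
    (P.trans (P.cong suc (majFrom-suc 1 (y ∷ u))) (P.sym (NP.+-suc (maj (y ∷ u)) (des (y ∷ u)))))

  distrib-swap : ∀ a b X Y → a * (b * X) + a * (b * Y) ≈ b * (a * (X + Y))
  distrib-swap = solve 4 (λ a b X Y → a :* (b :* X) :+ a :* (b :* Y) := b :* (a :* (X :+ Y))) ≈-refl

  weight-endsWithL : ∀ e v → endsWithL v ≡ true → weight e v ≈ 0#
  weight-endsWithL e v ends rewrite ends | BP.∧-zeroʳ (des v ≡ᵇ e) = ≈-refl

  -- Simultaneous induction on u for the three sums.  For u = x y u' the first letter x is
  -- prepended to the insertions into y u'; it is an ascent before L and before y iff x ≤ y.
  sumJ-closed  : ∀ x u M → Shape (x ∷ u) M → Closes sumJ gfJ (x ∷ u) M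
  sumL-closed  : ∀ x u M → Shape (x ∷ u) M → Closes sumL gfL (x ∷ u) M
  insertionSum : ∀ x u M → Shape (x ∷ u) M → Closes sumI gfI (x ∷ u) M
  sumJ-ascent  : ∀ x y u M → x < L → All (_< L) (y ∷ u) → (y <ᵇ x) ≡ false →
                 suc (length (y ∷ u)) ≡ des (y ∷ u) ℕ.+ suc M → ∀ a e →
                 sumJ (x ∷ y ∷ u) a e ≈ pow q (majFrom 2 (y ∷ u)) * shifted (des (y ∷ u)) (gfJ (des (y ∷ u)) M a) e
  sumJ-descent : ∀ x y u M → x < L → Shape (y ∷ u) M → (y <ᵇ x) ≡ true → ∀ a e →
                 sumJ (x ∷ y ∷ u) a e ≈ pow q (suc (majFrom 2 (y ∷ u))) * shifted (suc (des (y ∷ u))) (gfJ (suc (des (y ∷ u))) M a) e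

  -- A one-letter word x < L: the only insertion not ending with L is x itself.
  sumJ-closed x [] zero (x<L ∷ [] , refl) zero zero rewrite ≡ᵇ-false-< x<L =
    trans (+-identityʳ _) (sym (trans (*-identityˡ _) (trans (*-identityʳ _) (*-identityʳ _))))
  sumJ-closed x [] zero (x<L ∷ [] , refl) zero (suc e) =
    trans (+-identityʳ _) (sym (trans (*-identityˡ _) (trans (*-congʳ (zeroʳ _)) (zeroˡ _))))
  sumJ-closed x [] zero (x<L ∷ [] , refl) (suc a) e =
    trans (reflexive (∑-cons x (I [] (suc a)) (weight e)))
      (trans (∑-zeroᴬ {f = λ v → weight e (x ∷ v)}
               (AllP.++⁺ (AllP.map⁺ (All.map (λ {w} ends → weight-endsWithL e (x ∷ L ∷ w) ends) (I[]-endsWithL a))) []))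
        (sym (trans (*-identityˡ _) (vanishes e))))
    where
    vanishes : ∀ e → shifted 0 (gfJ 0 0 (suc a)) e ≈ 0#
    vanishes zero    = zeroʳ _
    vanishes (suc e) = trans (*-congʳ (zeroʳ _)) (zeroˡ _)
  sumJ-closed x (y ∷ u) M (x<L ∷ hs , len) a e with y <ᵇ x in y?x
  ... | false = sumJ-ascent x y u M x<L hs y?x len a e
  ... | true  = sumJ-descent x y u M x<L (hs , NP.suc-injective len) y?x a e

  sumJ-ascent x y u zero    x<L hs x≤y len a e =
    ⊥-elim (NP.<-irrefl (P.sym (NP.suc-injective (P.trans len (NP.+-comm (des (y ∷ u)) 1)))) (des<length y u))
  sumJ-ascent x y u (suc M) x<L hs x≤y len a e = begin
    sumJ (x ∷ y ∷ u) a e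
      ≈⟨ reflexive (∑-cons x (I (y ∷ u) a) (weight e)) ⟩
    ∑ (λ v → weight e (x ∷ v)) (I (y ∷ u) a)
      ≈⟨ ∑-prepend-ascent x y u a e x≤y (<ᵇ-false (NP.<⇒≤ x<L)) ⟩
    pow q e * sumI (y ∷ u) a e
      ≈⟨ *-congˡ (insertionSum y u M (hs , NP.suc-injective (P.trans len (NP.+-suc K (suc M)))) a e) ⟩
    pow q e * (pow q (maj (y ∷ u)) * shifted K (gfI K M a) e)
      ≈⟨ x∙yz≈y∙xz _ _ _ ⟩
    pow q (maj (y ∷ u)) * (pow q e * shifted K (gfI K M a) e)
      ≈⟨ *-congˡ (ascent K M a e) ⟩
    pow q (maj (y ∷ u)) * (pow q K * shifted K (gfJ K (suc M) a) e)
      ≈⟨ pow-maj _ (maj (y ∷ u)) K _ (majFrom-suc 1 (y ∷ u)) ⟩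
    pow q (majFrom 2 (y ∷ u)) * shifted K (gfJ K (suc M) a) e ∎
    where
    K : ℕ
    K = des (y ∷ u)

  sumJ-descent x y u M x<L shape y<x zero zero =
    trans (reflexive (∑-cons x (I (y ∷ u) 0) (weight 0))) (trans (∑-prepend-descent-J-0 x y u 0 y<x) (sym (zeroʳ _)))
  sumJ-descent x y u M x<L shape y<x zero (suc e) =
    trans (reflexive (∑-cons x (I (y ∷ u) 0) (weight (suc e))))
      (trans (∑-prepend-descent-J x y u 0 e y<x)
      (trans (*-congˡ (sumJ-closed y u M shape 0 e))
      (trans (x∙yz≈y∙xz _ _ _) (trans (*-congˡ (descent-zero (des (y ∷ u)) M e)) (pow-maj-descent y u)))))
  sumJ-descent x y u M x<L shape y<x (suc a) zero =
    trans (reflexive (∑-cons x (I (y ∷ u) (suc a)) (weight 0)))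
      (trans (∑-I-suc (y ∷ u) a (λ v → weight 0 (x ∷ v)))
      (trans (+-cong (trans (∑-prepend-L x (y ∷ u) a 0 (<ᵇ-false (NP.<⇒≤ x<L)))
                       (trans (*-congˡ (trans (sumL-closed y u M shape a 0)
                                         (trans (*-congˡ (shifted-gfL-≤ (des (y ∷ u)) M a 0 z≤n)) (zeroʳ _)))) (zeroʳ _)))
                     (∑-prepend-descent-J-0 x y u (suc a) y<x))
      (trans (+-identityʳ _) (sym (zeroʳ _)))))
  sumJ-descent x y u M x<L shape y<x (suc a) (suc e) =
    trans (reflexive (∑-cons x (I (y ∷ u) (suc a)) (weight (suc e))))
      (trans (∑-I-suc (y ∷ u) a (λ v → weight (suc e) (x ∷ v)))
      (trans (+-cong (trans (∑-prepend-L x (y ∷ u) a (suc e) (<ᵇ-false (NP.<⇒≤ x<L))) (*-congˡ (sumL-closed y u M shape a (suc e))))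
                     (trans (∑-prepend-descent-J x y u (suc a) e y<x) (*-congˡ (sumJ-closed y u M shape (suc a) e))))
      (trans (distrib-swap _ _ _ _) (trans (*-congˡ (descent-suc (des (y ∷ u)) M a e)) (pow-maj-descent y u)))))

  sumL-closed x u M shape@(x<L ∷ hs , len) zero zero =
    trans (reflexive (∑-cons x (I u 0) (λ v → weight 0 (L ∷ v))))
      (trans (∑-descent-0 L x (I u 0) (<ᵇ-true x<L)) (sym (trans (*-congˡ (shifted-gfL-≤ (des (x ∷ u)) M 0 0 z≤n)) (zeroʳ _))))
  sumL-closed x u M shape@(x<L ∷ hs , len) zero (suc e) =
    trans (∑-prepend-descent-J L x u 0 e (<ᵇ-true x<L))
      (trans (*-congˡ (sumJ-closed x u M shape 0 e))
      (trans (x∙yz≈y∙xz _ _ _) (*-congˡ (leadL-zero (des (x ∷ u)) M e))))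
  sumL-closed x u M shape@(x<L ∷ hs , len) (suc a) zero =
    trans (∑-I-suc (x ∷ u) a (λ v → weight 0 (L ∷ v)))
      (trans (+-cong (trans (∑-prepend-L L (x ∷ u) a 0 (<ᵇ-false {L} {L} NP.≤-refl))
                       (trans (*-congˡ (trans (sumL-closed x u M shape a 0)
                                         (trans (*-congˡ (shifted-gfL-≤ (des (x ∷ u)) M a 0 z≤n)) (zeroʳ _)))) (zeroʳ _)))
                     (∑-prepend-descent-J-0 L x u (suc a) (<ᵇ-true x<L)))
      (trans (+-identityʳ _) (sym (trans (*-congˡ (shifted-gfL-≤ (des (x ∷ u)) M (suc a) 0 z≤n)) (zeroʳ _)))))
  sumL-closed x u M shape@(x<L ∷ hs , len) (suc a) (suc e) =
    trans (∑-I-suc (x ∷ u) a (λ v → weight (suc e) (L ∷ v)))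
      (trans (+-cong (trans (∑-prepend-L L (x ∷ u) a (suc e) (<ᵇ-false {L} {L} NP.≤-refl)) (*-congˡ (sumL-closed x u M shape a (suc e))))
                     (trans (∑-prepend-descent-J L x u (suc a) e (<ᵇ-true x<L)) (*-congˡ (sumJ-closed x u M shape (suc a) e))))
      (trans (distrib-swap _ _ _ _) (*-congˡ (leadL-suc (des (x ∷ u)) M a e))))

  insertionSum x u M shape zero    e = trans (sumJ-closed x u M shape 0 e) (*-congˡ (all-zero (des (x ∷ u)) M e))
  insertionSum x u M shape (suc a) e = trans (∑-I-suc (x ∷ u) a (weight e))
    (trans (+-cong (sumL-closed x u M shape a e) (sumJ-closed x u M shape (suc a) e))
      (trans (sym (distribˡ _ _ _)) (*-congˡ (all-suc (des (x ∷ u)) M a e))))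

module AtInverse {c ℓ : Level} (R : CommutativeRing c ℓ) (q q⁻ : CommutativeRing.Carrier R)
                 (inv : CommutativeRing._≈_ R (CommutativeRing._*_ R q q⁻) (CommutativeRing.1# R)) where
  open RingKit R
  open SetoidReasoning setoid
  open QSymmetric R q
  open ClosedForms R q using (gfI)
  private module Q⁻ = QSymmetric R q⁻

  pow-inv : ∀ n → pow q n * pow q⁻ n ≈ 1#
  pow-inv = pow-inverse q q⁻ inv

  H-pascal⁻ : ∀ j S → hsym (suc j) (powers q⁻ (suc S)) ≈ hsym j (powers q⁻ (suc S)) + pow q⁻ (suc j) * hsym (suc j) (powers q⁻ S)
  H-pascal⁻ j S = trans (reflexive (P.cong (hsym (suc j)) (Q⁻.powers-cons S)))
    (+-cong (trans (*-identityˡ _) (reflexive (P.cong (hsym j) (P.sym (Q⁻.powers-cons S))))) (hsym-scale q⁻ (suc j) (powers q⁻ S)))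

  H-at-inverse : ∀ j S → pow q (j ℕ.* S) * hsym j (powers q⁻ S) ≈ pow q j * hsym j (powers q S)
  H-at-inverse zero S = ≈-refl
  H-at-inverse (suc j) zero = trans (zeroʳ _) (sym (zeroʳ _))
  H-at-inverse (suc j) (suc S) = begin
     pow q (suc j ℕ.* suc S) * hsym (suc j) (powers q⁻ (suc S))
       ≈⟨ *-congˡ (H-pascal⁻ j S) ⟩
     pow q (suc j ℕ.* suc S) * (hsym j (powers q⁻ (suc S)) + pow q⁻ (suc j) * hsym (suc j) (powers q⁻ S))
       ≈⟨ distribˡ _ _ _ ⟩
     pow q (suc j ℕ.* suc S) * hsym j (powers q⁻ (suc S)) + pow q (suc j ℕ.* suc S) * (pow q⁻ (suc j) * hsym (suc j) (powers q⁻ S))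
       ≈⟨ +-cong (trans (*-congʳ (trans (pow-cong q (exponent₁ j S)) (pow-+ q (suc S) (j ℕ.* suc S)))) (*-assoc _ _ _))
                 (trans (*-congʳ (trans (pow-cong q (exponent₂ j S)) (pow-+ q (suc j ℕ.* S) (suc j))))
                   (trans (cancel-shape _ _ _ _) (*-congˡ (trans (*-congʳ (pow-inv (suc j))) (*-identityˡ _))))) ⟩
     pow q (suc S) * (pow q (j ℕ.* suc S) * hsym j (powers q⁻ (suc S))) + pow q (suc j ℕ.* S) * hsym (suc j) (powers q⁻ S)
       ≈⟨ +-cong (*-congˡ (H-at-inverse j (suc S))) (H-at-inverse (suc j) S) ⟩
     pow q (suc S) * (pow q j * hsym j (powers q (suc S))) + pow q (suc j) * hsym (suc j) (powers q S)
       ≈⟨ +-congʳ (swap-shape q (pow q S) (pow q j) _) ⟩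
     pow q (suc j) * (pow q S * hsym j (powers q (suc S))) + pow q (suc j) * hsym (suc j) (powers q S)
       ≈⟨ sym (distribˡ _ _ _) ⟩
     pow q (suc j) * (pow q S * hsym j (powers q (suc S)) + hsym (suc j) (powers q S))
       ≈⟨ *-congˡ (sym (H-pascal j S)) ⟩
     pow q (suc j) * hsym (suc j) (powers q (suc S)) ∎
    where
    exponent₁ : ∀ j S → suc j ℕ.* suc S ≡ suc S ℕ.+ j ℕ.* suc S
    exponent₁ = solve-∀
    exponent₂ : ∀ j S → suc j ℕ.* suc S ≡ suc j ℕ.* S ℕ.+ suc j
    exponent₂ = solve-∀
    cancel-shape : ∀ a b c h → (a * b) * (c * h) ≈ a * ((b * c) * h)
    cancel-shape = solve 4 (λ a b c h → (a :* b) :* (c :* h) := a :* ((b :* c) :* h)) ≈-refl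
    swap-shape : ∀ q s p X → (q * s) * (p * X) ≈ (q * p) * (s * X)
    swap-shape = solve 4 (λ q s p X → (q :* s) :* (p :* X) := (q :* p) :* (s :* X)) ≈-refl

  -- The closed form of all insertions is the factor of the first product, with
  -- n_{ℓ-1} - k_{ℓ-1} = M + 1 and k_ℓ = K + d:  the q^{-(d choose 2)} of the q-binomial cancels.
  gfI-factor : ∀ K M a d → gfI K M a d ≈ pow q ((K ℕ.+ d) ℕ.* a) * qbinom q q⁻ (K ℕ.+ suc M) K d * multichoose q⁻ (K ℕ.+ d) a d
  gfI-factor K M a d rewrite ≤ᵇ-true (NP.m≤m+n K (suc M)) | NP.m+n∸m≡n K (suc M) with d NP.≤? a
  ... | no d≰a rewrite ≤ᵇ-false (NP.≰⇒> d≰a) = trans (zeroʳ _) (sym (zeroʳ _))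
  ... | yes d≤a = sym (begin
      pow q (S ℕ.* a) * (pow q⁻ Cd * E d (suc M)) * multichoose q⁻ S a d
        ≈⟨ *-congˡ (reflexive (P.cong (λ b → if b then hsym j (powers q⁻ S) else 0#) (≤ᵇ-true d≤a))) ⟩
      pow q (S ℕ.* a) * (pow q⁻ Cd * E d (suc M)) * hsym j (powers q⁻ S)
        ≈⟨ *-congʳ (*-congʳ (trans (pow-cong q exS) (trans (pow-+ q (X ℕ.+ Cd) (j ℕ.* S)) (*-congʳ (pow-+ q X Cd))))) ⟩
      (pow q X * pow q Cd * pow q (j ℕ.* S)) * (pow q⁻ Cd * E d (suc M)) * hsym j (powers q⁻ S)
        ≈⟨ regroup _ _ _ _ _ _ ⟩
      pow q X * (pow q Cd * pow q⁻ Cd) * E d (suc M) * (pow q (j ℕ.* S) * hsym j (powers q⁻ S))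
        ≈⟨ *-cong (*-congʳ (trans (*-congˡ (pow-inv Cd)) (*-identityʳ _))) (H-at-inverse j S) ⟩
      pow q X * E d (suc M) * (pow q j * hsym j (powers q S))
        ≈⟨ gather _ _ _ _ ⟩
      (pow q X * pow q j) * E d (suc M) * hsym j (powers q S)
        ≈⟨ *-cong (*-congʳ (trans (sym (pow-+ q X j)) (pow-cong q exL))) (reflexive (P.sym H∸≡H)) ⟩
      gfI K M a d ∎)
    where
    Cd S j X : ℕ
    Cd = d C 2
    S = K ℕ.+ d
    j = a ∸ d
    X = d ℕ.* K ℕ.+ Cd ℕ.+ d
    H∸≡H : H∸ a d S ≡ H j S
    H∸≡H = P.cong (λ b → if b then H j S else 0#) (≤ᵇ-true d≤a)
    a≡ : a ≡ d ℕ.+ j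
    a≡ = P.sym (NP.m+[n∸m]≡n d≤a)
    exS : S ℕ.* a ≡ X ℕ.+ Cd ℕ.+ j ℕ.* S
    exS = P.trans (P.cong (S ℕ.*_) a≡) (P.trans (ex1 K d j)
            (P.trans (P.cong (λ w → d ℕ.* K ℕ.+ w ℕ.+ j ℕ.* (K ℕ.+ d)) (P.sym (C2-sq d))) (ex2 (d ℕ.* K) Cd d (j ℕ.* (K ℕ.+ d)))))
      where
      ex1 : ∀ K d j → (K ℕ.+ d) ℕ.* (d ℕ.+ j) ≡ d ℕ.* K ℕ.+ d ℕ.* d ℕ.+ j ℕ.* (K ℕ.+ d)
      ex1 = solve-∀
      ex2 : ∀ a c d b → a ℕ.+ (c ℕ.+ c ℕ.+ d) ℕ.+ b ≡ a ℕ.+ c ℕ.+ d ℕ.+ c ℕ.+ b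
      ex2 = solve-∀
    exL : X ℕ.+ j ≡ d ℕ.* K ℕ.+ Cd ℕ.+ a
    exL = P.trans (NP.+-assoc (d ℕ.* K ℕ.+ Cd) d j) (P.cong (d ℕ.* K ℕ.+ Cd ℕ.+_) (P.sym a≡))
    regroup : ∀ x c s qc e h → (x * c * s) * (qc * e) * h ≈ x * (c * qc) * e * (s * h)
    regroup = solve 6 (λ x c s qc e h → (x :* c :* s) :* (qc :* e) :* h := x :* (c :* qc) :* e :* (s :* h)) ≈-refl
    gather : ∀ x e p h → x * e * (p * h) ≈ (x * p) * e * h
    gather = solve 4 (λ x e p h → x :* e :* (p :* h) := (x :* p) :* e :* h) ≈-refl

  q⁻-to-q : ∀ k a d (QB : Carrier) → d ℕ.≤ a →
        pow q (k ℕ.* a) * QB * multichoose q⁻ k a d ≈ pow q (k ℕ.* d ℕ.+ (a ∸ d)) * (QB * multichoose q k a d)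
  q⁻-to-q k a d QB d≤a rewrite ≤ᵇ-true d≤a = begin
      pow q (k ℕ.* a) * QB * hsym j (powers q⁻ k)
        ≈⟨ *-congʳ (*-congʳ (trans (pow-cong q ex) (pow-+ q (k ℕ.* d) (j ℕ.* k)))) ⟩
      (pow q (k ℕ.* d) * pow q (j ℕ.* k)) * QB * hsym j (powers q⁻ k)
        ≈⟨ regroup _ _ _ _ ⟩
      pow q (k ℕ.* d) * QB * (pow q (j ℕ.* k) * hsym j (powers q⁻ k))
        ≈⟨ *-congˡ (H-at-inverse j k) ⟩
      pow q (k ℕ.* d) * QB * (pow q j * hsym j (powers q k))
        ≈⟨ gather _ _ _ _ ⟩
      (pow q (k ℕ.* d) * pow q j) * (QB * hsym j (powers q k))
        ≈⟨ *-congʳ (sym (pow-+ q (k ℕ.* d) j)) ⟩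
      pow q (k ℕ.* d ℕ.+ j) * (QB * hsym j (powers q k)) ∎
    where
    j : ℕ
    j = a ∸ d
    ex : k ℕ.* a ≡ k ℕ.* d ℕ.+ j ℕ.* k
    ex = P.trans (P.cong (k ℕ.*_) (P.sym (NP.m+[n∸m]≡n d≤a))) (P.trans (NP.*-distribˡ-+ k d j) (P.cong (k ℕ.* d ℕ.+_) (NP.*-comm k j)))
    regroup : ∀ a b c h → (a * b) * c * h ≈ a * c * (b * h)
    regroup = solve 4 (λ a b c h → (a :* b) :* c :* h := a :* c :* (b :* h)) ≈-refl
    gather : ∀ a c b h → a * c * (b * h) ≈ (a * b) * (c * h)
    gather = solve 4 (λ a c b h → a :* c :* (b :* h) := (a :* b) :* (c :* h)) ≈-refl

  multichoose-vanishes : ∀ x k a d → a ℕ.< d → multichoose x k a d ≡ 0#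
  multichoose-vanishes x k a d h rewrite ≤ᵇ-false h = refl

-- Every word over {1,…,L} (L = m'+1) is an insertion of some number a of letters L into a
-- unique word over {1,…,m'}: a sum over all words of length n is a convolution over a + b = n.

letters-in-range : ∀ m → All (λ c → 1 ≤ c × c ≤ m) (map suc (upTo m))
letters-in-range m = AllP.map⁺ (All.map (λ h → s≤s z≤n , h) (upTo-< m))

allWords-valid : ∀ m n → All (λ w → All (λ c → 1 ≤ c × c ≤ m) w × length w ≡ n) (allWords m n)
allWords-valid m zero    = ([] , refl) ∷ []
allWords-valid m (suc n) = AllP.concat⁺ (AllP.map⁺ (All.map
  (λ {c} hc → AllP.map⁺ (All.map (λ {w} (hw , hl) → (hc ∷ hw) , P.cong suc hl) (allWords-valid m n)))
  (letters-in-range m)))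

module Decomposition {c ℓ : Level} (R : CommutativeRing c ℓ) (m' : ℕ) where
  open RingKit R
  open SetoidReasoning setoid
  open Insertion (suc m')
  open InsertionSums R (suc m')

  -- conv n G = Σ_{a+b=n} G a b.
  conv : ℕ → (ℕ → ℕ → Carrier) → Carrier
  conv zero    G = G 0 0
  conv (suc n) G = G 0 (suc n) + conv n (λ a b → G (suc a) b)

  conv-snoc : ∀ n G → conv (suc n) G ≈ conv n (λ a b → G a (suc b)) + G (suc n) 0
  conv-snoc zero    G = ≈-refl
  conv-snoc (suc n) G = trans (+-congˡ (conv-snoc n (λ a b → G (suc a) b))) (sym (+-assoc _ _ _))

  conv-cong : ∀ n {G H} → (∀ a b → G a b ≈ H a b) → conv n G ≈ conv n H
  conv-cong zero    h = h 0 0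
  conv-cong (suc n) h = +-cong (h 0 (suc n)) (conv-cong n (λ a b → h (suc a) b))

  conv-+ : ∀ n G H → conv n (λ a b → G a b + H a b) ≈ conv n G + conv n H
  conv-+ zero    G H = ≈-refl
  conv-+ (suc n) G H = trans (+-congˡ (conv-+ n _ _))
    (solve 4 (λ a b c d → (a :+ b) :+ (c :+ d) := (a :+ c) :+ (b :+ d)) ≈-refl _ _ _ _)

  conv-∑ : ∀ {A : Set} n (G : A → ℕ → ℕ → Carrier) (xs : List A) →
           conv n (λ a b → ∑ (λ x → G x a b) xs) ≈ ∑ (λ x → conv n (G x)) xs
  conv-∑ zero    G xs = ≈-refl
  conv-∑ (suc n) G xs = trans (+-congˡ (conv-∑ n (λ x a b → G x (suc a) b) xs)) (sym (∑-+ _ _ xs))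

  conv-zero : ∀ n G → (∀ a b → G a b ≈ 0#) → conv n G ≈ 0#
  conv-zero zero    G h = h 0 0
  conv-zero (suc n) G h = trans (+-cong (h 0 (suc n)) (conv-zero n _ (λ a b → h (suc a) b))) (+-identityʳ _)

  conv-single : ∀ n a₀ G → (∀ a b → (a ≡ a₀ → ⊥) → G a b ≈ 0#) → a₀ ≤ n → conv n G ≈ G a₀ (n ∸ a₀)
  conv-single zero    zero     G h _       = ≈-refl
  conv-single (suc n) zero     G h _       = trans (+-congˡ (conv-zero n _ (λ a b → h (suc a) b (λ ())))) (+-identityʳ _)
  conv-single (suc n) (suc a₀) G h (s≤s p) =
    trans (+-cong (h 0 (suc n) (λ ())) (conv-single n a₀ _ (λ a b ne → h (suc a) b (λ e → ne (NP.suc-injective e))) p))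
      (+-identityˡ _)

  sumInsertions : ℕ → (Word → Carrier) → Carrier
  sumInsertions n f = conv n (λ a b → ∑ (λ u → ∑ f (I u a)) (allWords m' b))

  ∑-allWords-suc : ∀ m n (f : Word → Carrier) →
                   ∑ f (allWords m (suc n)) ≈ ∑ (λ c → ∑ (λ w → f (c ∷ w)) (allWords m n)) (map suc (upTo m))
  ∑-allWords-suc m n f = trans (∑-concatMap f (λ c → map (c ∷_) (allWords m n)) (map suc (upTo m)))
    (∑-cong (map suc (upTo m)) (λ c → reflexive (∑-map f (c ∷_) (allWords m n))))

  ∑-letters-snoc : ∀ (g : ℕ → Carrier) → ∑ g (map suc (upTo (suc m'))) ≈ ∑ g (map suc (upTo m')) + g (suc m')
  ∑-letters-snoc g = trans (reflexive (P.cong (∑ g) (map-upTo-snoc suc m')))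
    (trans (∑-++ g (map suc (upTo m')) [ suc m' ]) (+-congˡ (+-identityʳ _)))

  -- The insertions not starting with L start with the first letter c ≤ m' of u.
  sumJ : (Word → Carrier) → ℕ → ℕ → Carrier
  sumJ f a b = ∑ (λ u → ∑ f (J u a)) (allWords m' b)

  conv-sumJ : ∀ n f → conv (suc n) (sumJ f) ≈ ∑ (λ c → sumInsertions n (λ w → f (c ∷ w))) (map suc (upTo m'))
  conv-sumJ n f = trans (conv-snoc n (sumJ f)) (trans (+-congˡ (+-identityʳ _)) (trans (+-identityʳ _)
    (trans (conv-cong n byFirstLetter) (conv-∑ n (λ c a b → ∑ (λ u → ∑ (λ w → f (c ∷ w)) (I u a)) (allWords m' b)) (map suc (upTo m'))))))
    where
    byFirstLetter : ∀ a b → sumJ f a (suc b) ≈ ∑ (λ c → ∑ (λ u → ∑ (λ w → f (c ∷ w)) (I u a)) (allWords m' b)) (map suc (upTo m'))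
    byFirstLetter a b = trans (∑-allWords-suc m' b (λ u → ∑ f (J u a)))
      (∑-cong (map suc (upTo m')) (λ c → ∑-cong (allWords m' b) (λ u → reflexive (∑-cons c (I u a) f))))

  sumInsertions-suc : ∀ n f → sumInsertions (suc n) f ≈ sumInsertions n (λ w → f (suc m' ∷ w)) + conv (suc n) (sumJ f)
  sumInsertions-suc n f = trans
    (+-congˡ (trans (conv-cong n (λ a b → trans (∑-cong (allWords m' b) (λ u → ∑-I-suc u a f)) (∑-+ _ _ (allWords m' b))))
                    (conv-+ n _ _)))
    (solve 3 (λ a b c → a :+ (b :+ c) := b :+ (a :+ c)) ≈-refl _ _ _)

  ∑-allWords≈sumInsertions : ∀ n (f : Word → Carrier) → ∑ f (allWords (suc m') n) ≈ sumInsertions n f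
  ∑-allWords≈sumInsertions zero    f = sym (+-identityʳ _)
  ∑-allWords≈sumInsertions (suc n) f = begin
    ∑ f (allWords (suc m') (suc n))
      ≈⟨ ∑-allWords-suc (suc m') n f ⟩
    ∑ (λ c → ∑ (λ w → f (c ∷ w)) (allWords (suc m') n)) (map suc (upTo (suc m')))
      ≈⟨ ∑-letters-snoc _ ⟩
    ∑ (λ c → ∑ (λ w → f (c ∷ w)) (allWords (suc m') n)) (map suc (upTo m')) + ∑ (λ w → f (suc m' ∷ w)) (allWords (suc m') n)
      ≈⟨ +-cong (∑-cong (map suc (upTo m')) (λ c → ∑-allWords≈sumInsertions n (λ w → f (c ∷ w))))
                (∑-allWords≈sumInsertions n (λ w → f (suc m' ∷ w))) ⟩
    ∑ (λ c → sumInsertions n (λ w → f (c ∷ w))) (map suc (upTo m')) + sumInsertions n (λ w → f (suc m' ∷ w))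
      ≈⟨ +-comm _ _ ⟩
    sumInsertions n (λ w → f (suc m' ∷ w)) + ∑ (λ c → sumInsertions n (λ w → f (c ∷ w))) (map suc (upTo m'))
      ≈⟨ +-congˡ (sym (conv-sumJ n f)) ⟩
    sumInsertions n (λ w → f (suc m' ∷ w)) + conv (suc n) (sumJ f)
      ≈⟨ sym (sumInsertions-suc n f) ⟩
    sumInsertions (suc n) f ∎

-- Bookkeeping for the products over ℓ = 2, …, m: the ℓ-th factor depends only on
-- (α_ℓ, δ_ℓ, k_ℓ, n_{ℓ-1}, k_{ℓ-1}), which do not change when a part is appended.

Local : Set
Local = ℕ × ℕ × ℕ × ℕ × ℕ

local : List ℕ → List ℕ → ℕ → Local
local α δ l = nth α l , nth δ l , psum δ l , psum α (l ∸ 1) , psum δ (l ∸ 1)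

module Products {c ℓ : Level} (R : CommutativeRing c ℓ) (q q⁻ : CommutativeRing.Carrier R) where
  open RingKit R

  factor₁ factor₂ : Local → Carrier
  factor₁ (a , d , k , n' , k') = pow q (k ℕ.* a) * qbinom q q⁻ n' k' d * multichoose q⁻ k a d
  factor₂ (a , d , k , n' , k') = qbinom q q⁻ n' k' d * multichoose q k a d

  d-choose-2 : Local → ℕ
  d-choose-2 (a , d , _) = d C 2

  from2-snoc : ∀ k → from2 (suc (suc k)) ≡ from2 (suc k) ++ [ suc (suc k) ]
  from2-snoc k = map-upTo-snoc (λ i → suc (suc i)) k

  from2-range : ∀ k → All (λ l → 1 ≤ l × l ≤ suc k) (from2 (suc k))
  from2-range k = AllP.map⁺ (All.map (λ h → s≤s z≤n , s≤s h) (upTo-< k))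

  prod-snoc : ∀ xs y → prod (xs ++ [ y ]) ≈ prod xs * y
  prod-snoc []       y = trans (*-identityʳ y) (sym (*-identityˡ y))
  prod-snoc (x ∷ xs) y = trans (*-congˡ (prod-snoc xs y)) (sym (*-assoc _ _ _))

  -- Appending a part: α = α' a₀, δ = δ' d₀ with m = k + 2 parts.
  module _ (α' δ' : List ℕ) (a₀ d₀ k : ℕ) (hα : length α' ≡ suc k) (hδ : length δ' ≡ suc k) where
    private
      α δ : List ℕ
      α = α' ++ [ a₀ ]
      δ = δ' ++ [ d₀ ]

      K N : ℕ
      K = sum δ'
      N = sum α'

    local-snoc : ∀ l → 1 ≤ l → l ≤ suc k → local α δ l ≡ local α' δ' l
    local-snoc l 1≤l l≤ = P.cong₂ _,_ (nth-snoc α' a₀ l 1≤l l≤α) (P.cong₂ _,_ (nth-snoc δ' d₀ l 1≤l l≤δ)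
      (P.cong₂ _,_ (psum-snoc δ' d₀ l l≤δ)
      (P.cong₂ _,_ (psum-snoc α' a₀ (l ∸ 1) (pred≤ {α'} hα)) (psum-snoc δ' d₀ (l ∸ 1) (pred≤ {δ'} hδ)))))
      where
      l≤α : l ≤ length α'
      l≤α = P.subst (l ≤_) (P.sym hα) l≤
      l≤δ : l ≤ length δ'
      l≤δ = P.subst (l ≤_) (P.sym hδ) l≤
      pred≤ : ∀ {xs : List ℕ} → length xs ≡ suc k → l ∸ 1 ≤ length xs
      pred≤ h = P.subst (l ∸ 1 ≤_) (P.sym h) (NP.≤-trans (NP.m∸n≤m l 1) l≤)

    local-last : local α δ (suc (suc k)) ≡ (a₀ , d₀ , K ℕ.+ d₀ , N , K)
    local-last = P.cong₂ _,_ (P.subst (λ m → nth α (suc m) ≡ a₀) hα (nth-last α' a₀))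
      (P.cong₂ _,_ (P.subst (λ m → nth δ (suc m) ≡ d₀) hδ (nth-last δ' d₀))
      (P.cong₂ _,_ (P.subst (λ m → psum δ (suc m) ≡ K ℕ.+ d₀) hδ (psum-all-snoc δ' d₀))
      (P.cong₂ _,_ (P.subst (λ m → psum α m ≡ N) hα (psum-all α' a₀)) (P.subst (λ m → psum δ m ≡ K) hδ (psum-all δ' d₀)))))

    map-local-snoc : ∀ {a} {A : Set a} (F : Local → A) →
                     map (λ l → F (local α δ l)) (from2 (length α))
                     ≡ map (λ l → F (local α' δ' l)) (from2 (length α')) ++ [ F (a₀ , d₀ , K ℕ.+ d₀ , N , K) ]
    map-local-snoc F rewrite length-snoc α' a₀ | hα = P.trans (P.cong (map (λ l → F (local α δ l))) (from2-snoc k))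
      (P.trans (LP.map-++ _ (from2 (suc k)) [ suc (suc k) ])
      (P.cong₂ _++_ (LP.map-cong-local (All.map (λ (1≤l , l≤) → P.cong F (local-snoc _ 1≤l l≤)) (from2-range k)))
                    (P.cong (λ t → [ F t ]) local-last)))

    rhs₁-snoc : rhs₁ q q⁻ α δ ≈ rhs₁ q q⁻ α' δ' * factor₁ (a₀ , d₀ , K ℕ.+ d₀ , N , K)
    rhs₁-snoc = trans (reflexive (P.cong prod (map-local-snoc factor₁)))
      (prod-snoc (map (λ l → factor₁ (local α' δ' l)) (from2 (length α'))) _)

    prod₂-snoc : prod (map (λ l → factor₂ (local α δ l)) (from2 (length α)))
                 ≈ prod (map (λ l → factor₂ (local α' δ' l)) (from2 (length α'))) * factor₂ (a₀ , d₀ , K ℕ.+ d₀ , N , K)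
    prod₂-snoc = trans (reflexive (P.cong prod (map-local-snoc factor₂)))
      (prod-snoc (map (λ l → factor₂ (local α' δ' l)) (from2 (length α'))) _)

    -- η grows by a₀ + (k_m choose 2) - (k_{m-1} choose 2) + (δ_m choose 2) = k_m δ_m + (a₀ - d₀).
    eta-snoc : d₀ ≤ a₀ → eta α δ ≡ eta α' δ' ℕ.+ ((K ℕ.+ d₀) ℕ.* d₀ ℕ.+ (a₀ ∸ d₀))
    eta-snoc d₀≤a₀ = begin
      eta α δ
        ≡⟨ P.cong₂ (λ x y → x ℕ.+ y ℕ.+ sum (map (λ l → d-choose-2 (local α δ l)) (from2 (length α)))) first-part k-choose-2 ⟩
      (A ℕ.+ a₀) ℕ.+ (K C 2 ℕ.+ K ℕ.* d₀ ℕ.+ d₀ C 2) ℕ.+ sum (map (λ l → d-choose-2 (local α δ l)) (from2 (length α)))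
        ≡⟨ P.cong (λ xs → (A ℕ.+ a₀) ℕ.+ (K C 2 ℕ.+ K ℕ.* d₀ ℕ.+ d₀ C 2) ℕ.+ sum xs) (map-local-snoc d-choose-2) ⟩
      (A ℕ.+ a₀) ℕ.+ (K C 2 ℕ.+ K ℕ.* d₀ ℕ.+ d₀ C 2) ℕ.+ sum (map (λ l → d-choose-2 (local α' δ' l)) (from2 (length α')) ++ [ d₀ C 2 ])
        ≡⟨ P.cong₂ (λ w s → (A ℕ.+ w) ℕ.+ (K C 2 ℕ.+ K ℕ.* d₀ ℕ.+ d₀ C 2) ℕ.+ s) a₀≡
                   (sum-snoc (map (λ l → d-choose-2 (local α' δ' l)) (from2 (length α'))) (d₀ C 2)) ⟩
      (A ℕ.+ (d₀ ℕ.+ j)) ℕ.+ (K C 2 ℕ.+ K ℕ.* d₀ ℕ.+ d₀ C 2) ℕ.+ (S' ℕ.+ d₀ C 2)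
        ≡⟨ regroup A (K C 2) K d₀ (d₀ C 2) S' j ⟩
      A ℕ.+ K C 2 ℕ.+ S' ℕ.+ (K ℕ.* d₀ ℕ.+ (d₀ C 2 ℕ.+ d₀ C 2 ℕ.+ d₀) ℕ.+ j)
        ≡⟨ P.cong (λ w → A ℕ.+ K C 2 ℕ.+ S' ℕ.+ (K ℕ.* d₀ ℕ.+ w ℕ.+ j)) (C2-sq d₀) ⟩
      A ℕ.+ K C 2 ℕ.+ S' ℕ.+ (K ℕ.* d₀ ℕ.+ d₀ ℕ.* d₀ ℕ.+ j)
        ≡⟨ P.cong (λ w → A ℕ.+ K C 2 ℕ.+ S' ℕ.+ (w ℕ.+ j)) (P.sym (NP.*-distribʳ-+ d₀ K d₀)) ⟩
      eta α' δ' ℕ.+ ((K ℕ.+ d₀) ℕ.* d₀ ℕ.+ j) ∎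
      where
      open P.≡-Reasoning
      A S' j : ℕ
      A = sum α' ∸ nth α' 1
      S' = sum (map (λ l → nth δ' l C 2) (from2 (length α')))
      j = a₀ ∸ d₀
      a₀≡ : a₀ ≡ d₀ ℕ.+ j
      a₀≡ = P.sym (NP.m+[n∸m]≡n d₀≤a₀)
      first-part : sum α ∸ nth α 1 ≡ A ℕ.+ a₀
      first-part = P.trans (P.cong₂ _∸_ (sum-snoc α' a₀) (nth-snoc α' a₀ 1 (s≤s z≤n) (P.subst (1 ≤_) (P.sym hα) (s≤s z≤n))))
                     (NP.+-∸-comm a₀ (nth1≤sum α'))
      k-choose-2 : sum δ C 2 ≡ K C 2 ℕ.+ K ℕ.* d₀ ℕ.+ d₀ C 2
      k-choose-2 = P.trans (P.cong (_C 2) (sum-snoc δ' d₀)) (C2-+ K d₀)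
      regroup : ∀ A K2 K d c S j → A ℕ.+ (d ℕ.+ j) ℕ.+ (K2 ℕ.+ K ℕ.* d ℕ.+ c) ℕ.+ (S ℕ.+ c)
                                   ≡ A ℕ.+ K2 ℕ.+ S ℕ.+ (K ℕ.* d ℕ.+ (c ℕ.+ c ℕ.+ d) ℕ.+ j)
      regroup = solve-∀

module Step {c ℓ : Level} (R : CommutativeRing c ℓ) (q q⁻ : CommutativeRing.Carrier R)
            (inv : CommutativeRing._≈_ R (CommutativeRing._*_ R q q⁻) (CommutativeRing.1# R))
            (m' : ℕ) (1≤m' : 1 ≤ m') where
  open RingKit R
  open SetoidReasoning setoid
  open Insertion (suc m')
  open InsertionSum R q (suc m') using (weight; sumI; insertionSum)
  open ClosedForms R q using (gfI; shifted-at)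
  open AtInverse R q q⁻ inv using (gfI-factor)
  open Decomposition R m' using (conv; conv-cong; conv-single; ∑-allWords≈sumInsertions)
  open Products R q q⁻ using (factor₁)

  L : ℕ
  L = suc m'

  -- A truth table: the membership test of v split into that of u, the count a and the weight.
  when-table : ∀ c' ca t' td l ne (X : Carrier) b → (l ≡ true → ne ≡ true → td ≡ b) →
               when ((c' ∧ ca) ∧ ((t' ∧ td) ∧ (l ∧ ne))) X ≈ when ca (when (c' ∧ (t' ∧ l)) (when (b ∧ ne) X))
  when-table false false t'    td    l     ne    X b     h = ≈-refl
  when-table false true  t'    td    l     ne    X b     h = ≈-refl
  when-table true  false t'    td    l     ne    X b     h = ≈-refl
  when-table true  true  false td    l     ne    X b     h = ≈-refl
  when-table true  true  true  false false ne    X b     h = ≈-refl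
  when-table true  true  true  true  false ne    X b     h = ≈-refl
  when-table true  true  true  false true  false X false h = ≈-refl
  when-table true  true  true  false true  false X true  h = ≈-refl
  when-table true  true  true  true  true  false X false h = ≈-refl
  when-table true  true  true  true  true  false X true  h = ≈-refl
  when-table true  true  true  td    true  true  X b     h with h refl refl
  ... | refl with td
  ...   | true  = ≈-refl
  ...   | false = ≈-refl

  content-inserted : ∀ {u a v} → All (_< L) u → Inserted u a v → content L v ≡ content m' u ++ [ a ]
  content-inserted {u} {a} {v} hu ins = P.trans (content-snoc m' v) (P.cong₂ _++_
    (LP.map-cong-local (All.map (λ {i} i<m' → Inserted.count-below ins (suc i) (s≤s i<m')) (upTo-< m')))
    (P.cong [_] (P.trans (Inserted.count-L ins) (P.trans (P.cong (a ℕ.+_) (count-absent L u hu)) (NP.+-identityʳ a)))))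

  CDT-inserted : ∀ {u a v} → All (_≤ m') u → All (_≤ L) v → Inserted u a v →
                 CDT L v ≡ CDT m' u ++ [ (ℤ.+ cdes v) ℤ.- (ℤ.+ cdes u) ]
  CDT-inserted {u} {a} {v} hu hv ins = P.trans (CDT-snoc m' v) (P.cong₂ _++_
    (LP.map-cong-local (All.map (λ {i} i<m' → P.cong₂ (λ x y → (ℤ.+ cdes x) ℤ.- (ℤ.+ cdes y))
        (restrict-below (suc i) (s≤s i<m')) (restrict-below i (NP.m<n⇒m<1+n i<m'))) (upTo-< m')))
    (P.cong [_] (P.cong₂ (λ x y → (ℤ.+ cdes x) ℤ.- (ℤ.+ cdes y)) (restrict-all L v hv)
       (P.trans (restrict-below m' (NP.n<1+n m')) (restrict-all m' u hu)))))
    where open Inserted ins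

  module _ (α' δ' : List ℕ) (a₀ d₀ : ℕ) (hα : length α' ≡ m') (hδ : length δ' ≡ m') where
    α δ : List ℕ
    α = α' ++ [ a₀ ]
    δ = δ' ++ [ d₀ ]

    length-α : length α ≡ L
    length-α = P.trans (length-snoc α' a₀) (P.cong suc hα)

    membership : ∀ u a v → All (λ c → 1 ≤ c × c ≤ m') u → Inserted u a v →
                 when (inW α δ v) (pow q (maj v)) ≈ when (does (a ℕ.≟ a₀)) (when (inW α' δ' u) (weight (des u ℕ.+ d₀) v))
    membership u a v hu ins = goal
      where
      hu< : All (_< L) u
      hu< = All.map (λ p → s≤s (proj₂ p)) hu
      hv : All (λ c → 1 ≤ c × c ≤ L) v
      hv = Inserted.letters ins (s≤s z≤n , NP.≤-refl) (All.map (λ p → proj₁ p , NP.m≤n⇒m≤1+n (proj₂ p)) hu)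
      content≡ : content L v ≡ content m' u ++ [ a ]
      content≡ = content-inserted hu< ins
      CDT≡ : CDT L v ≡ CDT m' u ++ [ (ℤ.+ cdes v) ℤ.- (ℤ.+ cdes u) ]
      CDT≡ = CDT-inserted (All.map proj₂ hu) (All.map proj₂ hv) ins
      last≡ : lastIs1 v ≡ lastIs1 u ∧ not (endsWithL v)
      last≡ = lastIs1-inserted u v (s≤s 1≤m') hu< (Inserted.ends ins)
      c' ca t' td l ne : Bool
      c' = does (LP.≡-dec ℕ._≟_ (content m' u) α')
      ca = does (a ℕ.≟ a₀)
      t' = does (LP.≡-dec ℤ._≟_ (CDT m' u) (map ℤ.+_ δ'))
      td = does (((ℤ.+ cdes v) ℤ.- (ℤ.+ cdes u)) ℤ.≟ ℤ.+ d₀)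
      l  = lastIs1 u
      ne = not (endsWithL v)
      inW-v : inW α δ v ≡ (c' ∧ ca) ∧ ((t' ∧ td) ∧ (l ∧ ne))
      inW-v rewrite length-α | content≡ | CDT≡ | last≡ | LP.map-++ ℤ.+_ δ' [ d₀ ]
        | ≡-dec-snoc ℕ._≟_ (content m' u) α' a a₀ (P.trans (length-content m' u) (P.sym hα))
        | ≡-dec-snoc ℤ._≟_ (CDT m' u) (map ℤ.+_ δ') ((ℤ.+ cdes v) ℤ.- (ℤ.+ cdes u)) (ℤ.+ d₀)
                     (P.trans (length-CDT m' u) (P.sym (P.trans (LP.length-map ℤ.+_ δ') hδ))) = refl
      inW-u : inW α' δ' u ≡ c' ∧ (t' ∧ l)
      inW-u rewrite hα = refl
      -- Once both words end with 1, cyclic descents are descents.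
      td≡ : l ≡ true → ne ≡ true → td ≡ (des v ≡ᵇ des u ℕ.+ d₀)
      td≡ l≡ ne≡ = P.trans (diff-test (cdes v) (cdes u) d₀)
        (P.cong₂ (λ x y → x ≡ᵇ y ℕ.+ d₀) (cdes≡des v (P.trans last≡ (P.cong₂ _∧_ l≡ ne≡)) (All.map proj₁ hv))
                                        (cdes≡des u l≡ (All.map proj₁ hu)))
      goal : when (inW α δ v) (pow q (maj v)) ≈ when ca (when (inW α' δ' u) (weight (des u ℕ.+ d₀) v))
      goal rewrite inW-v | inW-u = when-table c' ca t' td l ne (pow q (maj v)) (des v ≡ᵇ des u ℕ.+ d₀) td≡

    factorAt : ℕ → ℕ → Carrier
    factorAt N K = factor₁ (a₀ , d₀ , K ℕ.+ d₀ , N , K)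

    factor : Carrier
    factor = factorAt (sum α') (sum δ')

    -- A member u of W̃(α',δ') has des u = k_{m-1}, as its CDT telescopes to cdes u.
    des-member : ∀ u → All (λ c → 1 ≤ c × c ≤ m') u → inW α' δ' u ≡ true → des u ≡ sum δ'
    des-member u hu member = P.trans (P.sym (cdes≡des u last (All.map proj₁ hu)))
      (P.trans (P.cong cdes (P.sym (restrict-all m' u (All.map proj₂ hu)))) (cdes-telescope m' u δ' (All.map proj₁ hu) hδ CDT≡))
      where
      c' : Bool
      c' = does (LP.≡-dec ℕ._≟_ (content m' u) α')
      member' : c' ∧ (does (LP.≡-dec ℤ._≟_ (CDT m' u) (map ℤ.+_ δ')) ∧ lastIs1 u) ≡ true
      member' = P.trans (P.cong (λ m → does (LP.≡-dec ℕ._≟_ (content m u) α')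
                                       ∧ (does (LP.≡-dec ℤ._≟_ (CDT m u) (map ℤ.+_ δ')) ∧ lastIs1 u)) (P.sym hα)) member
      CDT≡ : CDT m' u ≡ map ℤ.+_ δ'
      CDT≡ = does-true (LP.≡-dec ℤ._≟_ (CDT m' u) (map ℤ.+_ δ')) (proj₁ (∧-true _ _ (proj₂ (∧-true c' _ member'))))
      last : lastIs1 u ≡ true
      last = proj₂ (∧-true _ _ (proj₂ (∧-true c' _ member')))

    insertions-member : ∀ u → All (λ c → 1 ≤ c × c ≤ m') u → length u ≡ sum α' → 1 ≤ sum α' →
                        when (inW α' δ' u) (sumI u a₀ (des u ℕ.+ d₀)) ≈ when (inW α' δ' u) (pow q (maj u)) * factor
    insertions-member u hu len 1≤n with inW α' δ' u in member
    ... | false = sym (zeroˡ _)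
    ... | true  = closed u hu len (des-member u hu member)
      where
      closed : ∀ u → All (λ c → 1 ≤ c × c ≤ m') u → length u ≡ sum α' → des u ≡ sum δ' →
               sumI u a₀ (des u ℕ.+ d₀) ≈ pow q (maj u) * factor
      closed []       _  len _    = ⊥-elim (NP.<-irrefl len 1≤n)
      closed (x ∷ u₁) hu len des≡ = begin
        sumI (x ∷ u₁) a₀ (K ℕ.+ d₀)
          ≈⟨ insertionSum x u₁ M (All.map (λ p → s≤s (proj₂ p)) hu , length≡) a₀ (K ℕ.+ d₀) ⟩
        pow q (maj (x ∷ u₁)) * ClosedForms.shifted R q K (gfI K M a₀) (K ℕ.+ d₀)
          ≈⟨ *-congˡ (trans (shifted-at K (gfI K M a₀) d₀) (gfI-factor K M a₀ d₀)) ⟩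
        pow q (maj (x ∷ u₁)) * factorAt (K ℕ.+ suc M) K
          ≈⟨ *-congˡ (reflexive (P.cong₂ factorAt (P.trans (P.sym length≡) len) des≡)) ⟩
        pow q (maj (x ∷ u₁)) * factor ∎
        where
        K M : ℕ
        K = des (x ∷ u₁)
        M = sum α' ∸ suc K
        K<n : K < sum α'
        K<n = P.subst (K <_) len (des<length x u₁)
        length≡ : length (x ∷ u₁) ≡ K ℕ.+ suc M
        length≡ = P.trans len (P.trans (P.sym (NP.m+[n∸m]≡n K<n)) (P.sym (NP.+-suc K M)))

    memberWeight : Word → Carrier
    memberWeight w = when (inW α δ w) (pow q (maj w))

    memberInsertions : ℕ → ℕ → Carrier
    memberInsertions a b = ∑ (λ u → when (inW α' δ' u) (sumI u a (des u ℕ.+ d₀))) (allWords m' b)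

    ∑-membership : ∀ a b → ∑ (λ u → ∑ memberWeight (I u a)) (allWords m' b) ≈ when (does (a ℕ.≟ a₀)) (memberInsertions a b)
    ∑-membership a b = trans
      (∑-congᴬ (All.map (λ {u} (hu , _) →
          trans (∑-congᴬ (All.map (membership u a _ hu) (inserted-I u a (All.map (λ p → s≤s (proj₂ p)) hu))))
                (trans (∑-when _ _ (I u a)) (when-cong (does (a ℕ.≟ a₀)) (∑-when _ _ (I u a)))))
        (allWords-valid m' b)))
      (∑-when _ _ (allWords m' b))

    -- W̃(α,δ) = W̃(α',δ') · factor: only a = a₀ contributes to the convolution.
    wordSumStep : 1 ≤ sum α' → Wmaj q α δ ≈ Wmaj q α' δ' * factor
    wordSumStep 1≤n = begin
      Wmaj q α δ
        ≈⟨ reflexive (P.cong₂ (λ m n → ∑ memberWeight (allWords m n)) length-α (sum-snoc α' a₀)) ⟩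
      ∑ memberWeight (allWords L (n ℕ.+ a₀))
        ≈⟨ ∑-allWords≈sumInsertions (n ℕ.+ a₀) memberWeight ⟩
      conv (n ℕ.+ a₀) (λ a b → ∑ (λ u → ∑ memberWeight (I u a)) (allWords m' b))
        ≈⟨ conv-cong (n ℕ.+ a₀) ∑-membership ⟩
      conv (n ℕ.+ a₀) G
        ≈⟨ conv-single (n ℕ.+ a₀) a₀ G (λ a b a≢a₀ → reflexive (P.cong (λ t → when t (memberInsertions a b)) (≡ᵇ-false a≢a₀)))
                       (NP.m≤n+m a₀ n) ⟩
      G a₀ ((n ℕ.+ a₀) ∸ a₀)
        ≈⟨ reflexive (P.trans (P.cong (G a₀) (NP.m+n∸n≡m n a₀)) (P.cong (λ t → when t (memberInsertions a₀ n)) (≡ᵇ-refl a₀))) ⟩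
      memberInsertions a₀ n
        ≈⟨ ∑-congᴬ (All.map (λ {u} (hu , len) → insertions-member u hu len 1≤n) (allWords-valid m' n)) ⟩
      ∑ (λ u → when (inW α' δ' u) (pow q (maj u)) * factor) (allWords m' n)
        ≈⟨ ∑-*ʳ _ factor (allWords m' n) ⟩
      ∑ (λ u → when (inW α' δ' u) (pow q (maj u))) (allWords m' n) * factor
        ≈⟨ *-congʳ (reflexive (P.cong (λ m → ∑ (λ u → when (inW α' δ' u) (pow q (maj u))) (allWords m n)) (P.sym hα))) ⟩
      Wmaj q α' δ' * factor ∎
      where
      n : ℕ
      n = sum α'
      G : ℕ → ℕ → Carrier
      G a b = when (does (a ℕ.≟ a₀)) (memberInsertions a b)

-- The base case m = 1: the only word is 1ⁿ, with maj 0 and no cyclic descents.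

ones : ℕ → Word
ones zero    = []
ones (suc n) = 1 ∷ ones n

allWords-one : ∀ n → allWords 1 n ≡ [ ones n ]
allWords-one zero                            = refl
allWords-one (suc n) rewrite allWords-one n = refl

ones-valid : ∀ n → All (λ c → 1 ≤ c × c ≤ 1) (ones n)
ones-valid zero    = []
ones-valid (suc n) = (NP.≤-refl , NP.≤-refl) ∷ ones-valid n

maj-ones : ∀ i n → majFrom i (ones n) ≡ 0
maj-ones i zero          = refl
maj-ones i (suc zero)    = refl
maj-ones i (suc (suc n)) = maj-ones (suc i) (suc n)

des-ones : ∀ n → des (ones n) ≡ 0
des-ones zero          = refl
des-ones (suc zero)    = refl
des-ones (suc (suc n)) = des-ones (suc n)

lastIs1-ones : ∀ n → lastIs1 (ones (suc n)) ≡ true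
lastIs1-ones zero    = refl
lastIs1-ones (suc n) = lastIs1-ones n

count-ones : ∀ n → count 1 (ones n) ≡ n
count-ones zero    = refl
count-ones (suc n) = P.cong suc (count-ones n)

ones-member : ∀ n → inW [ suc n ] [ 0 ] (ones (suc n)) ≡ true
ones-member n = P.trans
  (P.cong₂ (λ A B → does (LP.≡-dec ℕ._≟_ A [ suc n ]) ∧ (does (LP.≡-dec ℤ._≟_ B [ ℤ.+ 0 ]) ∧ lastIs1 w)) content≡ CDT≡)
  (P.cong₂ (λ b l → (b ∧ true) ∧ (true ∧ l)) (≡ᵇ-refl n) (lastIs1-ones n))
  where
  w : Word
  w = ones (suc n)
  content≡ : content 1 w ≡ [ suc n ]
  content≡ = P.cong [_] (count-ones (suc n))
  cdes≡ : cdes (restrict 1 w) ≡ 0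
  cdes≡ = P.trans (P.cong cdes (restrict-all 1 w (All.map proj₂ (ones-valid (suc n)))))
            (P.trans (cdes≡des w (lastIs1-ones n) (All.map proj₁ (ones-valid (suc n)))) (des-ones (suc n)))
  CDT≡ : CDT 1 w ≡ [ ℤ.+ 0 ]
  CDT≡ = P.cong₂ (λ a b → [ (ℤ.+ a) ℤ.- (ℤ.+ b) ]) cdes≡ (P.cong cdes (restrict-zero w (All.map proj₁ (ones-valid (suc n)))))

module Induction {c ℓ : Level} (R : CommutativeRing c ℓ) (q q⁻ : CommutativeRing.Carrier R)
                 (inv : CommutativeRing._≈_ R (CommutativeRing._*_ R q q⁻) (CommutativeRing.1# R)) where
  open RingKit R
  open SetoidReasoning setoid
  open Products R q q⁻
  open AtInverse R q q⁻ inv using (q⁻-to-q; multichoose-vanishes)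

  wordSum-base : ∀ n → Wmaj q [ suc n ] [ 0 ] ≈ 1#
  wordSum-base n = begin
    Wmaj q [ suc n ] [ 0 ]
      ≈⟨ reflexive (P.cong (λ m → ∑ g (allWords 1 m)) (NP.+-identityʳ (suc n))) ⟩
    ∑ g (allWords 1 (suc n))
      ≈⟨ reflexive (P.cong (∑ g) (allWords-one (suc n))) ⟩
    g (ones (suc n)) + 0#
      ≈⟨ +-identityʳ _ ⟩
    g (ones (suc n))
      ≈⟨ reflexive (P.trans (P.cong (λ b → when b (pow q (maj (ones (suc n))))) (ones-member n)) (P.cong (pow q) (maj-ones 1 (suc n)))) ⟩
    1# ∎
    where
    g : Word → Carrier
    g w = when (inW [ suc n ] [ 0 ] w) (pow q (maj w))

  nth1-init : ∀ δ' d₀ k → length δ' ≡ suc k → nth (δ' ++ [ d₀ ]) 1 ≡ 0 → nth δ' 1 ≡ 0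
  nth1-init δ' d₀ k hδ h = P.trans (P.sym (nth-snoc δ' d₀ 1 (s≤s z≤n) (P.subst (1 ≤_) (P.sym hδ) (s≤s z≤n)))) h

  sum-positive : ∀ xs → All (1 ≤_) xs → 1 ≤ length xs → 1 ≤ sum xs
  sum-positive (x ∷ xs) (1≤x ∷ _) _ = NP.≤-trans 1≤x (NP.m≤m+n x _)

  firstProduct : ∀ m α δ → length α ≡ suc m → length δ ≡ suc m → All (1 ≤_) α → nth δ 1 ≡ 0 →
                 Wmaj q α δ ≈ rhs₁ q q⁻ α δ
  firstProduct zero (zero  ∷ []) (0 ∷ []) _ _ (() ∷ []) refl
  firstProduct zero (suc n ∷ []) (0 ∷ []) _ _ _         refl = wordSum-base n
  firstProduct (suc m) α δ hl hd positive δ₁≡0 with snocView α (suc m) hl | snocView δ (suc m) hd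
  ... | α' , a₀ , refl , hα | δ' , d₀ , refl , hδ = begin
    Wmaj q (α' ++ [ a₀ ]) (δ' ++ [ d₀ ])
      ≈⟨ Step.wordSumStep R q q⁻ inv (suc m) (s≤s z≤n) α' δ' a₀ d₀ hα hδ
           (sum-positive α' positive' (P.subst (1 ≤_) (P.sym hα) (s≤s z≤n))) ⟩
    Wmaj q α' δ' * factor₁ (a₀ , d₀ , sum δ' ℕ.+ d₀ , sum α' , sum δ')
      ≈⟨ *-congʳ (firstProduct m α' δ' hα hδ positive' (nth1-init δ' d₀ m hδ δ₁≡0)) ⟩
    rhs₁ q q⁻ α' δ' * factor₁ (a₀ , d₀ , sum δ' ℕ.+ d₀ , sum α' , sum δ')
      ≈⟨ sym (rhs₁-snoc α' δ' a₀ d₀ m hα hδ) ⟩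
    rhs₁ q q⁻ (α' ++ [ a₀ ]) (δ' ++ [ d₀ ]) ∎
    where
    positive' : All (1 ≤_) α'
    positive' = AllP.++⁻ˡ α' positive

  module _ (α' δ' : List ℕ) (a₀ d₀ k : ℕ) (hα : length α' ≡ suc k) (hδ : length δ' ≡ suc k) where
    private
      K : ℕ
      K = sum δ'
      P₂ : Carrier
      P₂ = prod (map (λ l → factor₂ (local α' δ' l)) (from2 (length α')))
      new₁ new₂ : Carrier
      new₁ = factor₁ (a₀ , d₀ , K ℕ.+ d₀ , sum α' , K)
      new₂ = factor₂ (a₀ , d₀ , K ℕ.+ d₀ , sum α' , K)

    -- For δ_m ≤ α_m, the new factor at q⁻¹ is q^{k_m δ_m + α_m - δ_m} times that at q, which is
    -- the increase of η.
    secondProduct-≤ : rhs₁ q q⁻ α' δ' ≈ rhs₂ q q⁻ α' δ' → d₀ ≤ a₀ →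
                      rhs₁ q q⁻ (α' ++ [ a₀ ]) (δ' ++ [ d₀ ]) ≈ rhs₂ q q⁻ (α' ++ [ a₀ ]) (δ' ++ [ d₀ ])
    secondProduct-≤ IH d₀≤a₀ = begin
      rhs₁ q q⁻ (α' ++ [ a₀ ]) (δ' ++ [ d₀ ])
        ≈⟨ rhs₁-snoc α' δ' a₀ d₀ k hα hδ ⟩
      rhs₁ q q⁻ α' δ' * new₁
        ≈⟨ *-cong IH (q⁻-to-q (K ℕ.+ d₀) a₀ d₀ (qbinom q q⁻ (sum α') K d₀) d₀≤a₀) ⟩
      (pow q (eta α' δ') * P₂) * (pow q Δ * new₂)
        ≈⟨ solve 4 (λ a b c d → (a :* b) :* (c :* d) := (a :* c) :* (b :* d)) ≈-refl _ _ _ _ ⟩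
      (pow q (eta α' δ') * pow q Δ) * (P₂ * new₂)
        ≈⟨ *-cong (trans (sym (pow-+ q (eta α' δ') Δ)) (pow-cong q (P.sym (eta-snoc α' δ' a₀ d₀ k hα hδ d₀≤a₀))))
                  (sym (prod₂-snoc α' δ' a₀ d₀ k hα hδ)) ⟩
      rhs₂ q q⁻ (α' ++ [ a₀ ]) (δ' ++ [ d₀ ]) ∎
      where
      Δ : ℕ
      Δ = (K ℕ.+ d₀) ℕ.* d₀ ℕ.+ (a₀ ∸ d₀)

    -- For δ_m > α_m both sides vanish, through the factor ((k_m choose α_m - δ_m)).
    secondProduct-> : a₀ < d₀ → rhs₁ q q⁻ (α' ++ [ a₀ ]) (δ' ++ [ d₀ ]) ≈ rhs₂ q q⁻ (α' ++ [ a₀ ]) (δ' ++ [ d₀ ])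
    secondProduct-> a₀<d₀ = begin
      rhs₁ q q⁻ (α' ++ [ a₀ ]) (δ' ++ [ d₀ ])
        ≈⟨ rhs₁-snoc α' δ' a₀ d₀ k hα hδ ⟩
      rhs₁ q q⁻ α' δ' * new₁
        ≈⟨ *-congˡ (trans (*-congˡ (reflexive (multichoose-vanishes q⁻ _ a₀ d₀ a₀<d₀))) (zeroʳ _)) ⟩
      rhs₁ q q⁻ α' δ' * 0#
        ≈⟨ zeroʳ _ ⟩
      0#
        ≈⟨ sym (trans (*-congˡ (*-congˡ (trans (*-congˡ (reflexive (multichoose-vanishes q _ a₀ d₀ a₀<d₀))) (zeroʳ _))))
                      (trans (*-congˡ (zeroʳ _)) (zeroʳ _))) ⟩
      pow q (eta (α' ++ [ a₀ ]) (δ' ++ [ d₀ ])) * (P₂ * new₂)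
        ≈⟨ *-congˡ (sym (prod₂-snoc α' δ' a₀ d₀ k hα hδ)) ⟩
      rhs₂ q q⁻ (α' ++ [ a₀ ]) (δ' ++ [ d₀ ]) ∎

  secondProduct : ∀ m α δ → length α ≡ suc m → length δ ≡ suc m → nth δ 1 ≡ 0 → rhs₁ q q⁻ α δ ≈ rhs₂ q q⁻ α δ
  secondProduct zero (n ∷ []) (0 ∷ []) _ _ refl =
    sym (trans (*-congʳ (pow-cong q (P.cong (λ x → x ℕ.+ 0 ℕ.+ 0) (NP.m+n∸m≡n n 0)))) (*-identityʳ _))
  secondProduct (suc m) α δ hl hd δ₁≡0 with snocView α (suc m) hl | snocView δ (suc m) hd
  ... | α' , a₀ , refl , hα | δ' , d₀ , refl , hδ with d₀ NP.≤? a₀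
  ...   | yes d₀≤a₀ = secondProduct-≤ α' δ' a₀ d₀ m hα hδ (secondProduct m α' δ' hα hδ (nth1-init δ' d₀ m hδ δ₁≡0)) d₀≤a₀
  ...   | no  d₀≰a₀ = secondProduct-> α' δ' a₀ d₀ m hα hδ (NP.≰⇒> d₀≰a₀)

theorem5p17 : {c ℓ : Level} (R : CommutativeRing c ℓ)
    (q q⁻ : CommutativeRing.Carrier R) →
    CommutativeRing._≈_ R (CommutativeRing._*_ R q q⁻) (CommutativeRing.1# R) →
    (α δ : List ℕ) → All (1 ≤_) α → 1 ≤ sum α → length δ ≡ length α → nth δ 1 ≡ 0 →
    CommutativeRing._≈_ R (RingDefs.Wmaj R q α δ) (RingDefs.rhs₁ R q q⁻ α δ)
      × CommutativeRing._≈_ R (RingDefs.rhs₁ R q q⁻ α δ) (RingDefs.rhs₂ R q q⁻ α δ)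
theorem5p17 R q q⁻ inv []       δ positive () length≡ δ₁≡0
theorem5p17 R q q⁻ inv (x ∷ xs) δ positive _  length≡ δ₁≡0 =
  firstProduct (length xs) (x ∷ xs) δ refl length≡ positive δ₁≡0 ,
  secondProduct (length xs) (x ∷ xs) δ refl length≡ δ₁≡0
  where open Induction R q q⁻ inv
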